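{- Let $\mathcal{T}$ be a $\Sigma_1$-theory. If $\mathcal{T}$ is not stably infinite, or if $\mathcal{T}$ is strongly finitely witnessable, then $\mathcal{T}$ is gentle.
   Context: $\Sigma_1$ is the one-sorted first-order signature with no function or predicate symbols other than equality. Interpretations have non-empty domains and assign values to all variables; a theory is the class of all interpretations satisfying a given set of sentences (not necessarily computably enumerable). $\mathcal{T}$ is stably infinite if every $\mathcal{T}$-satisfiable quantifier-free formula is satisfied by a $\mathcal{T}$-interpretation with infinite domain. For a finite set of variables $V$ and an equivalence $E$ on $V$, the arrangement $\delta_V^E$ is $\bigwedge_{xEy}(x=y)\wedge\bigwedge_{\neg(xEy)}\neg(x=y)$. $\mathcal{T}$ is strongly finitely witnessable if there is a computable function $wit$ from quantifier-free formulas to quantifier-free formulas such that for every quantifier-free $\phi$: (I) $\phi$ and $\exists\vec{x}\,wit(\phi)$ are $\mathcal{T}$-equivalent, $\vec{x}=vars(wit(\phi))\setminus vars(\phi)$; (II*) for every finite $V$ and arrangement $\delta_V$, if $wit(\phi)\wedge\delta_V$ is $\mathcal{T}$-satisfiable, some $\mathcal{T}$-interpretation $\mathcal{A}$ satisfies it with domain equal to the set of values in $\mathcal{A}$ of the variables of $wit(\phi)\wedge\delta_V$. $\mathrm{Spec}(\mathcal{T},\phi)$ is the set of finite cardinalities of domains of $\mathcal{T}$-interpretations satisfying $\phi$. $\mathcal{T}$ is gentle if for every quantifier-free $\phi$: (i) $\mathrm{Spec}(\mathcal{T},\phi)$ is computable; (ii) it is either co-finite in $\mathbb{N}$ or finite,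 and an algorithm with input $\phi$ decides which; (iii) if finite, its maximum is computable from $\phi$, and if infinite, $\max(\mathbb{N}\setminus\mathrm{Spec}(\mathcal{T},\phi))$ is computable from $\phi$ (maximum of the empty set is $0$). -}

module Defs where

open import Level using (Level; 0ℓ) renaming (suc to lsuc)
open import Data.Nat using (ℕ; zero; suc; _+_; _*_; _≤_; _<_; _≟_; _≡ᵇ_)
open import Data.Fin using (Fin)
open import Data.Vec using (Vec; []; _∷_; lookup)
open import Data.List using (List; []; _∷_; _++_; filter; concatMap; map)
open import Data.List.Membership.Propositional using (_∈_)
open import Data.List.Membership.DecPropositional _≟_ using (_∈?_)
open import Data.Product using (Σ; _×_; _,_)
open import Data.Sum using (_⊎_)
open import Data.Unit using (⊤)
open import Data.Empty using (⊥)
open import Data.Bool using (if_then_else_)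
open import Relation.Nullary using (¬_; ¬?; yes; no)
open import Relation.Binary.PropositionalEquality using (_≡_)
open import Function.Bundles using (_↔_)

-- Syntax of first-order logic over Σ₁ (only equality).
-- Variables are natural numbers.

data Fm : Set where
  top : Fm
  eq  : ℕ → ℕ → Fm
  neg : Fm → Fm
  and : Fm → Fm → Fm
  ex  : ℕ → Fm → Fm

-- free variables (vars of a quantifier-free formula = all its variables)
fv : Fm → List ℕ
fv top       = []
fv (eq x y)  = x ∷ y ∷ []
fv (neg φ)   = fv φ
fv (and φ ψ) = fv φ ++ fv ψ
fv (ex x φ)  = filter (λ y → ¬? (y ≟ x)) (fv φ)

QF : Fm → Set
QF top       = ⊤
QF (eq _ _)  = ⊤
QF (neg φ)   = QF φ
QF (and φ ψ) = QF φ × QF ψ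
QF (ex _ _)  = ⊥

Sentence : Fm → Set
Sentence φ = fv φ ≡ []

exs : List ℕ → Fm → Fm
exs []       φ = φ
exs (x ∷ xs) φ = ex x (exs xs φ)

conj : List Fm → Fm
conj []       = top
conj (φ ∷ φs) = and φ (conj φs)

-- The arrangement δ_V^E, where the equivalence E on V is given by a
-- labelling e : x E y iff e x ≡ e y (every equivalence on a finite V
-- arises this way).
arr : List ℕ → (ℕ → ℕ) → Fm
arr V e = conj (concatMap (λ x → map (λ y → lit x y) V) V)
  where
  lit : ℕ → ℕ → Fm
  lit x y = if e x ≡ᵇ e y then eq x y else neg (eq x y)

-- Semantics. An interpretation: a domain and a value for every variable
-- (non-emptiness of the domain follows since variables get values).

record Interp : Set₁ where
  field
    D   : Set
    val : ℕ → D
open Interp public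

update : {D : Set} → (ℕ → D) → ℕ → D → ℕ → D
update v x d y with y ≟ x
... | yes _ = d
... | no  _ = v y

sat : (D : Set) → (ℕ → D) → Fm → Set
sat D v top       = ⊤
sat D v (eq x y)  = v x ≡ v y
sat D v (neg φ)   = ¬ sat D v φ
sat D v (and φ ψ) = sat D v φ × sat D v ψ
sat D v (ex x φ)  = Σ D λ d → sat D (update v x d) φ

_⊨_ : Interp → Fm → Set
A ⊨ φ = sat (D A) (val A) φ

-- Theories: the class of interpretations satisfying a set Γ of sentences.

TInterp : (Fm → Set) → Interp → Set
TInterp Γ A = ∀ ψ → Γ ψ → A ⊨ ψ

TSat : (Fm → Set) → Fm → Set₁
TSat Γ φ = Σ Interp λ A → TInterp Γ A × A ⊨ φ

TEquiv : (Fm → Set) → Fm → Fm → Set₁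
TEquiv Γ φ ψ = ∀ A → TInterp Γ A → (A ⊨ φ → A ⊨ ψ) × (A ⊨ ψ → A ⊨ φ)

FiniteType : Set → Set
FiniteType X = Σ ℕ λ n → X ↔ Fin n

InfiniteType : Set → Set
InfiniteType X = ¬ FiniteType X

StablyInfinite : (Fm → Set) → Set₁
StablyInfinite Γ = ∀ φ → QF φ → TSat Γ φ →
  Σ Interp λ A → TInterp Γ A × A ⊨ φ × InfiniteType (D A)

Spec : (Fm → Set) → Fm → ℕ → Set₁
Spec Γ φ n = Σ Interp λ A → TInterp Γ A × A ⊨ φ × (D A ↔ Fin n)

-- Computability: partial recursive (μ-recursive) functions with a
-- big-step evaluation relation, and a Gödel coding of formulas.

data PR : ℕ → Set where
  Z : ∀ {n} → PR n
  S : PR 1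
  P : ∀ {n} → Fin n → PR n
  C : ∀ {n m} → PR m → Vec (PR n) m → PR n
  R : ∀ {n} → PR n → PR (suc (suc n)) → PR (suc n)
  M : ∀ {n} → PR (suc n) → PR n

data _[_]⇓_ : ∀ {n} → PR n → Vec ℕ n → ℕ → Set
data _[_]⇓*_ : ∀ {n m} → Vec (PR n) m → Vec ℕ n → Vec ℕ m → Set

data _[_]⇓_ where
  Z⇓  : ∀ {n} {xs : Vec ℕ n} → Z [ xs ]⇓ 0
  S⇓  : ∀ {x} → S [ x ∷ [] ]⇓ suc x
  P⇓  : ∀ {n} {xs : Vec ℕ n} (i : Fin n) → P i [ xs ]⇓ lookup xs i
  C⇓  : ∀ {n m} {f : PR m} {gs : Vec (PR n) m} {xs ys y} →
        gs [ xs ]⇓* ys → f [ ys ]⇓ y → C f gs [ xs ]⇓ y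
  R0⇓ : ∀ {n} {f : PR n} {g} {xs y} → f [ xs ]⇓ y → R f g [ 0 ∷ xs ]⇓ y
  RS⇓ : ∀ {n} {f : PR n} {g} {xs k r y} →
        R f g [ k ∷ xs ]⇓ r → g [ k ∷ r ∷ xs ]⇓ y → R f g [ suc k ∷ xs ]⇓ y
  M⇓  : ∀ {n} {f : PR (suc n)} {xs z} →
        f [ z ∷ xs ]⇓ 0 →
        (∀ i → i < z → Σ ℕ λ v → f [ i ∷ xs ]⇓ suc v) →
        M f [ xs ]⇓ z

data _[_]⇓*_ where
  []⇓ : ∀ {n} {xs : Vec ℕ n} → [] [ xs ]⇓* []
  ∷⇓  : ∀ {n m} {g : PR n} {gs : Vec (PR n) m} {xs y ys} →
        g [ xs ]⇓ y → gs [ xs ]⇓* ys → (g ∷ gs) [ xs ]⇓* (y ∷ ys)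

tri : ℕ → ℕ
tri zero    = zero
tri (suc n) = suc n + tri n

pair : ℕ → ℕ → ℕ
pair a b = tri (a + b) + b

enc : Fm → ℕ
enc top       = 0
enc (eq x y)  = 1 + 5 * pair x y
enc (neg φ)   = 2 + 5 * enc φ
enc (and φ ψ) = 3 + 5 * pair (enc φ) (enc ψ)
enc (ex x φ)  = 4 + 5 * pair x (enc φ)

newVars : Fm → Fm → List ℕ
newVars φ w = filter (λ y → ¬? (y ∈? fv φ)) (fv w)

StronglyFinitelyWitnessable : (Fm → Set) → Set₁
StronglyFinitelyWitnessable Γ =
  Σ (Fm → Fm) λ wit →
    (Σ (PR 1) λ c → ∀ φ → QF φ → c [ enc φ ∷ [] ]⇓ enc (wit φ)) ×
    (∀ φ → QF φ →
       QF (wit φ) ×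
       TEquiv Γ φ (exs (newVars φ (wit φ)) (wit φ)) ×
       (∀ (V : List ℕ) (e : ℕ → ℕ) →
          TSat Γ (and (wit φ) (arr V e)) →
          Σ Interp λ A → TInterp Γ A × A ⊨ and (wit φ) (arr V e) ×
            (∀ (d : D A) → Σ ℕ λ x →
               x ∈ fv (and (wit φ) (arr V e)) × val A x ≡ d)))

FiniteSet : (ℕ → Set₁) → Set₁
FiniteSet X = Σ ℕ λ N → ∀ k → X k → k < N

CoFiniteSet : (ℕ → Set₁) → Set₁
CoFiniteSet X = Σ ℕ λ N → ∀ k → N ≤ k → X k

-- m is the maximum of S, where the maximum of the empty set is 0
IsMax : (ℕ → Set₁) → ℕ → Set₁
IsMax X m = (X m × (∀ k → X k → k ≤ m)) ⊎ ((∀ k → ¬ X k) × m ≡ 0)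

Gentle : (Fm → Set) → Set₁
Gentle Γ =
  (Σ (PR 2) λ c → ∀ φ → QF φ → ∀ n →
     (Spec Γ φ n → c [ enc φ ∷ n ∷ [] ]⇓ 1) ×
     (¬ Spec Γ φ n → c [ enc φ ∷ n ∷ [] ]⇓ 0)) ×
  (∀ φ → QF φ → FiniteSet (Spec Γ φ) ⊎ CoFiniteSet (Spec Γ φ)) ×
  (Σ (PR 1) λ c → ∀ φ → QF φ →
     (FiniteSet (Spec Γ φ) → c [ enc φ ∷ [] ]⇓ 1) ×
     (CoFiniteSet (Spec Γ φ) → c [ enc φ ∷ [] ]⇓ 0)) ×
  (Σ (PR 1) λ c → ∀ φ → QF φ →
     (FiniteSet (Spec Γ φ) →
        Σ ℕ λ m → IsMax (Spec Γ φ) m × c [ enc φ ∷ [] ]⇓ m) ×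
     (CoFiniteSet (Spec Γ φ) →
        Σ ℕ λ m → IsMax (λ k → ¬ Spec Γ φ k) m × c [ enc φ ∷ [] ]⇓ m))

-- Over the empty signature a sentence can only count elements, so whether an n-element set carries a
-- model of T depends on n alone, and a quantifier-free φ holds in a model of size n iff n is a model
-- size and φ is satisfiable in an n-element set. The latter is decidable from the code of φ by
-- enumerating valuations in base n, and it holds for all n > enc φ as soon as for one n. Hence Spec(T, φ)
-- is computable, with all of (i)-(iii), as soon as the set S of model sizes is finite or cofinite: then S
-- is given by a finite table, which excluded middle provides.
-- If T is not stably infinite, S is bounded: an Ehrenfeucht–Fraïssé argument turns arbitrarily large
-- finite models into a model on ℕ, where every satisfiable φ is satisfied. If T is strongly finitely
-- witnessable and S is unbounded, let c be least such that wit ⊤ is satisfiable in c elements; witnessing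
-- the arrangement of such a valuation extended by k fresh distinct values gives a model of size c + k.

module Submission where

open import Defs
open import Level using (Lift; lift; lower) renaming (suc to lsuc; zero to lzero)
open import Axiom.ExcludedMiddle using (ExcludedMiddle)
open import Data.Nat
open import Data.Nat.Properties
open import Data.Nat.DivMod using (_/_; _%_; m≡m%n+[m/n]*n; m%n<n)
open import Data.Nat.Tactic.RingSolver using (solve-∀)
open import Data.Fin as Fin using (Fin; #_; toℕ; fromℕ<) renaming (zero to fzero; suc to fsuc)
open import Data.Fin.Properties
  using (toℕ-injective; toℕ-fromℕ<; toℕ<n; pigeonhole; ¬∀⟶∃¬; all?; punchOut-cong; punchOut-injective)
open import Data.Vec using (Vec; []; _∷_; lookup; tabulate)
open import Data.Vec.Properties using (tabulate∘lookup)
open import Data.Product using (Σ; _×_; _,_; proj₁; proj₂)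
open import Data.Sum using (_⊎_; inj₁; inj₂)
open import Data.Empty using (⊥-elim)
open import Data.Unit using (⊤; tt)
open import Data.Bool using (true; false; T; if_then_else_)
open import Relation.Nullary using (¬_; ¬?; Dec; yes; no; contradiction)
open import Relation.Binary.PropositionalEquality
open import Function using (_∘_; _⇔_; mk⇔; _↔_; Injective; case_of_)
open import Function.Bundles using (module Equivalence; module Inverse; module Injection; mk↔ₛ′)
open import Function.Properties.Inverse using (↔-sym; ↔⇒↣)
open import Data.List using (List; []; _∷_; _++_; length; map; concatMap; cartesianProductWith; upTo)
open import Data.List.Properties using (length-map)
open import Data.List.Membership.Propositional using (_∈_; _∉_; find; lose)
open import Data.List.Membership.Propositional.Properties
  using (∈-++⁺ˡ; ∈-++⁺ʳ; ∈-++⁻; ∈-filter⁺; ∈-filter⁻; ∈-map⁺; ∈-upTo⁺; ∈-upTo⁻;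
         ∈-cartesianProductWith⁺; ∈-cartesianProductWith⁻)
open import Data.List.Relation.Unary.Any using (here; there; any?; index)
open import Data.List.Relation.Unary.Any.Properties using (lookup-index)
open import Data.Nat.ListAction using (sum)
open import Relation.Nullary.Decidable using (via-injection; _×-dec_) renaming (map to map-Dec)
open import Relation.Binary.Definitions using (DecidableEquality; tri<; tri≈; tri>)
open import Function.Properties.Equivalence using () renaming (refl to ⇔-refl; sym to ⇔-sym; trans to ⇔-trans)
open import Function.Related.TypeIsomorphisms using (→-cong-⇔)
open import Data.Product.Function.NonDependent.Propositional using (_×-⇔_)

open Equivalence using (to; from)

-- Primitive recursive expressions

data Exp : ℕ → Set where
  var               : ∀ {n} → Fin n → Exp n
  lit               : ∀ {n} → ℕ → Exp n
  add mul monus pow : ∀ {n} → Exp n → Exp n → Exp n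
  bsum              : ∀ {n} → Exp n → Exp (suc n) → Exp n
  rec               : ∀ {n} → Exp n → Exp n → Exp (suc (suc n)) → Exp n
  call              : ∀ {n m} → Exp m → Vec (Exp n) m → Exp n

Σ< : ℕ → (ℕ → ℕ) → ℕ
Σ< zero    f = 0
Σ< (suc k) f = Σ< k f + f k

iterate : ℕ → ℕ → (ℕ → ℕ → ℕ) → ℕ
iterate zero    b g = b
iterate (suc k) b g = g k (iterate k b g)

mutual
  ⟦_⟧ : ∀ {n} → Exp n → Vec ℕ n → ℕ
  ⟦ var i ⟧      xs = lookup xs i
  ⟦ lit c ⟧      xs = c
  ⟦ add a b ⟧    xs = ⟦ a ⟧ xs + ⟦ b ⟧ xs
  ⟦ mul a b ⟧    xs = ⟦ a ⟧ xs * ⟦ b ⟧ xs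
  ⟦ monus a b ⟧  xs = ⟦ a ⟧ xs ∸ ⟦ b ⟧ xs
  ⟦ pow a b ⟧    xs = ⟦ a ⟧ xs ^ ⟦ b ⟧ xs
  ⟦ bsum k f ⟧   xs = Σ< (⟦ k ⟧ xs) (λ i → ⟦ f ⟧ (i ∷ xs))
  ⟦ rec k b g ⟧  xs = iterate (⟦ k ⟧ xs) (⟦ b ⟧ xs) (λ i acc → ⟦ g ⟧ (i ∷ acc ∷ xs))
  ⟦ call g es ⟧  xs = ⟦ g ⟧ (⟦ es ⟧* xs)

  ⟦_⟧* : ∀ {n m} → Vec (Exp n) m → Vec ℕ n → Vec ℕ m
  ⟦ [] ⟧*     xs = []
  ⟦ e ∷ es ⟧* xs = ⟦ e ⟧ xs ∷ ⟦ es ⟧* xs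

⇓-cast : ∀ {n} {f : PR n} {xs y y′} → f [ xs ]⇓ y → y ≡ y′ → f [ xs ]⇓ y′
⇓-cast d refl = d

+ᴾ : PR 2
+ᴾ = R (P (# 0)) (C S (P (# 1) ∷ []))

+ᴾ⇓ : ∀ a b → +ᴾ [ a ∷ b ∷ [] ]⇓ (a + b)
+ᴾ⇓ zero    b = R0⇓ (P⇓ (# 0))
+ᴾ⇓ (suc a) b = RS⇓ (+ᴾ⇓ a b) (C⇓ (∷⇓ (P⇓ (# 1)) []⇓) S⇓)

*ᴾ : PR 2
*ᴾ = R Z (C +ᴾ (P (# 1) ∷ P (# 2) ∷ []))

*ᴾ⇓ : ∀ a b → *ᴾ [ a ∷ b ∷ [] ]⇓ (a * b)
*ᴾ⇓ zero    b = R0⇓ Z⇓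
*ᴾ⇓ (suc a) b = RS⇓ (*ᴾ⇓ a b)
  (⇓-cast (C⇓ (∷⇓ (P⇓ (# 1)) (∷⇓ (P⇓ (# 2)) []⇓)) (+ᴾ⇓ (a * b) b)) (+-comm (a * b) b))

predᴾ : PR 1
predᴾ = R Z (P (# 0))

predᴾ⇓ : ∀ a → predᴾ [ a ∷ [] ]⇓ pred a
predᴾ⇓ zero    = R0⇓ Z⇓
predᴾ⇓ (suc a) = RS⇓ (predᴾ⇓ a) (P⇓ (# 0))

∸ᴾ : PR 2
∸ᴾ = R (P (# 0)) (C predᴾ (P (# 1) ∷ []))

∸ᴾ⇓ : ∀ b a → ∸ᴾ [ b ∷ a ∷ [] ]⇓ (a ∸ b)
∸ᴾ⇓ zero    a = R0⇓ (P⇓ (# 0))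
∸ᴾ⇓ (suc b) a = RS⇓ (∸ᴾ⇓ b a)
  (⇓-cast (C⇓ (∷⇓ (P⇓ (# 1)) []⇓) (predᴾ⇓ (a ∸ b))) (pred[m∸n]≡m∸[1+n] a b))

^ᴾ : PR 2
^ᴾ = R (C S (Z ∷ [])) (C *ᴾ (P (# 1) ∷ P (# 2) ∷ []))

^ᴾ⇓ : ∀ b a → ^ᴾ [ b ∷ a ∷ [] ]⇓ (a ^ b)
^ᴾ⇓ zero    a = R0⇓ (C⇓ (∷⇓ Z⇓ []⇓) S⇓)
^ᴾ⇓ (suc b) a = RS⇓ (^ᴾ⇓ b a)
  (⇓-cast (C⇓ (∷⇓ (P⇓ (# 1)) (∷⇓ (P⇓ (# 2)) []⇓)) (*ᴾ⇓ (a ^ b) a)) (*-comm (a ^ b) a))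

constᴾ : ∀ {n} → ℕ → PR n
constᴾ zero    = Z
constᴾ (suc c) = C S (constᴾ c ∷ [])

constᴾ⇓ : ∀ {n} c (xs : Vec ℕ n) → constᴾ c [ xs ]⇓ c
constᴾ⇓ zero    xs = Z⇓
constᴾ⇓ (suc c) xs = C⇓ (∷⇓ (constᴾ⇓ c xs) []⇓) S⇓

projections : ∀ {n m} → (Fin n → Fin m) → Vec (PR m) n
projections ρ = tabulate (P ∘ ρ)

projections⇓ : ∀ {n m} (ρ : Fin n → Fin m) (ys : Vec ℕ m) →
               projections ρ [ ys ]⇓* tabulate (lookup ys ∘ ρ)
projections⇓ {zero}  ρ ys = []⇓
projections⇓ {suc n} ρ ys = ∷⇓ (P⇓ (ρ fzero)) (projections⇓ (ρ ∘ fsuc) ys)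

identity⇓ : ∀ {n} (xs : Vec ℕ n) → projections (λ i → i) [ xs ]⇓* xs
identity⇓ xs = subst (_ [ xs ]⇓*_) (tabulate∘lookup xs) (projections⇓ (λ i → i) xs)

drop₂⇓ : ∀ {n} k a (xs : Vec ℕ n) → projections (fsuc ∘ fsuc) [ k ∷ a ∷ xs ]⇓* xs
drop₂⇓ k a xs = subst (_ [ k ∷ a ∷ xs ]⇓*_) (tabulate∘lookup xs) (projections⇓ (fsuc ∘ fsuc) (k ∷ a ∷ xs))

bsumᴾ : ∀ {n} → PR (suc n) → PR (suc n)
bsumᴾ f = R Z (C +ᴾ (P (# 1) ∷ C f (P (# 0) ∷ projections (fsuc ∘ fsuc)) ∷ []))

mutual
  compile : ∀ {n} → Exp n → PR n
  compile (var i)     = P i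
  compile (lit c)     = constᴾ c
  compile (add a b)   = C +ᴾ (compile a ∷ compile b ∷ [])
  compile (mul a b)   = C *ᴾ (compile a ∷ compile b ∷ [])
  compile (monus a b) = C ∸ᴾ (compile b ∷ compile a ∷ [])
  compile (pow a b)   = C ^ᴾ (compile b ∷ compile a ∷ [])
  compile (bsum k f)  = C (bsumᴾ (compile f)) (compile k ∷ projections (λ i → i))
  compile (rec k b g) = C (R (compile b) (compile g)) (compile k ∷ projections (λ i → i))
  compile (call g es) = C (compile g) (compile* es)

  compile* : ∀ {n m} → Vec (Exp n) m → Vec (PR n) m
  compile* []       = []
  compile* (e ∷ es) = compile e ∷ compile* es

mutual
  compile-correct : ∀ {n} (e : Exp n) xs → compile e [ xs ]⇓ ⟦ e ⟧ xs
  compile-correct (var i)     xs = P⇓ i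
  compile-correct (lit c)     xs = constᴾ⇓ c xs
  compile-correct (add a b)   xs = C⇓ (∷⇓ (compile-correct a xs) (∷⇓ (compile-correct b xs) []⇓)) (+ᴾ⇓ _ _)
  compile-correct (mul a b)   xs = C⇓ (∷⇓ (compile-correct a xs) (∷⇓ (compile-correct b xs) []⇓)) (*ᴾ⇓ _ _)
  compile-correct (monus a b) xs = C⇓ (∷⇓ (compile-correct b xs) (∷⇓ (compile-correct a xs) []⇓)) (∸ᴾ⇓ _ _)
  compile-correct (pow a b)   xs = C⇓ (∷⇓ (compile-correct b xs) (∷⇓ (compile-correct a xs) []⇓)) (^ᴾ⇓ _ _)
  compile-correct (bsum k f)  xs = C⇓ (∷⇓ (compile-correct k xs) (identity⇓ xs)) (partial-sums (⟦ k ⟧ xs))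
    where
    partial-sums : ∀ j → bsumᴾ (compile f) [ j ∷ xs ]⇓ Σ< j (λ i → ⟦ f ⟧ (i ∷ xs))
    partial-sums zero    = R0⇓ Z⇓
    partial-sums (suc j) = RS⇓ (partial-sums j)
      (C⇓ (∷⇓ (P⇓ (# 1)) (∷⇓ (C⇓ (∷⇓ (P⇓ (# 0)) (drop₂⇓ j _ xs)) (compile-correct f (j ∷ xs))) []⇓))
          (+ᴾ⇓ _ _))
  compile-correct (rec k b g) xs = C⇓ (∷⇓ (compile-correct k xs) (identity⇓ xs)) (iterates (⟦ k ⟧ xs))
    where
    iterates : ∀ j → R (compile b) (compile g) [ j ∷ xs ]⇓
                     iterate j (⟦ b ⟧ xs) (λ i acc → ⟦ g ⟧ (i ∷ acc ∷ xs))
    iterates zero    = R0⇓ (compile-correct b xs)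
    iterates (suc j) = RS⇓ (iterates j) (compile-correct g _)
  compile-correct (call g es) xs = C⇓ (compile*-correct es xs) (compile-correct g (⟦ es ⟧* xs))

  compile*-correct : ∀ {n m} (es : Vec (Exp n) m) xs → compile* es [ xs ]⇓* ⟦ es ⟧* xs
  compile*-correct []       xs = []⇓
  compile*-correct (e ∷ es) xs = ∷⇓ (compile-correct e xs) (compile*-correct es xs)

-- Natural numbers as truth values: 0 is false, every positive number is true

0<m+n⇒0<m⊎0<n : ∀ m n → 0 < m + n → 0 < m ⊎ 0 < n
0<m+n⇒0<m⊎0<n zero    n p = inj₂ p
0<m+n⇒0<m⊎0<n (suc m) n p = inj₁ z<s

0<m⇒0<m+n : ∀ {m} n → 0 < m → 0 < m + n
0<m⇒0<m+n n p = ≤-trans p (m≤m+n _ n)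

0<n⇒0<m+n : ∀ m {n} → 0 < n → 0 < m + n
0<n⇒0<m+n m p = ≤-trans p (m≤n+m _ m)

0<m*n⇒0<m×0<n : ∀ m n → 0 < m * n → 0 < m × 0 < n
0<m*n⇒0<m×0<n (suc m) (suc n) p = z<s , z<s
0<m*n⇒0<m×0<n (suc m) zero    p = ⊥-elim (<-irrefl (sym (*-zeroʳ m)) p)

0<m⇒0<n⇒0<m*n : ∀ {m n} → 0 < m → 0 < n → 0 < m * n
0<m⇒0<n⇒0<m*n {suc m} {suc n} _ _ = z<s

0<m*n⇔ : ∀ m n → 0 < m * n ⇔ (0 < m × 0 < n)
0<m*n⇔ m n = mk⇔ (0<m*n⇒0<m×0<n m n) (λ (m>0 , n>0) → 0<m⇒0<n⇒0<m*n m>0 n>0)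

¬0<⇒≡0 : ∀ {n} → ¬ 0 < n → n ≡ 0
¬0<⇒≡0 = n≤0⇒n≡0 ∘ ≮⇒≥

0<m+n⇔ : ∀ m n → 0 < m + n ⇔ (0 < m ⊎ 0 < n)
0<m+n⇔ m n = mk⇔ (0<m+n⇒0<m⊎0<n m n) λ { (inj₁ m>0) → 0<m⇒0<m+n n m>0 ; (inj₂ n>0) → 0<n⇒0<m+n m n>0 }

0<1+n∸m⇔m≤n : ∀ m n → 0 < suc n ∸ m ⇔ m ≤ n
0<1+n∸m⇔m≤n m n =
  mk⇔ (λ p → ≤-pred (≰⇒> λ 1+n≤m → <⇒≢ p (sym (m≤n⇒m∸n≡0 1+n≤m)))) (m<n⇒0<n∸m ∘ s≤s)

0<1∸n⇒n≡0 : ∀ n → 0 < 1 ∸ n → n ≡ 0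
0<1∸n⇒n≡0 zero    _ = refl
0<1∸n⇒n≡0 (suc n) p = contradiction (subst (0 <_) (0∸n≡0 n) p) (<-irrefl refl)

0<1∸n⇔¬0<n : ∀ n → 0 < 1 ∸ n ⇔ (¬ 0 < n)
0<1∸n⇔¬0<n zero    = mk⇔ (λ _ ()) (λ _ → z<s)
0<1∸n⇔¬0<n (suc n) = mk⇔ (λ p → contradiction (0<1∸n⇒n≡0 (suc n) p) λ ()) (λ ¬p → contradiction z<s ¬p)

sg : ℕ → ℕ
sg n = 1 ∸ (1 ∸ n)

sg-pos : ∀ {n} → 0 < n → sg n ≡ 1
sg-pos {suc n} _ = cong (1 ∸_) (0∸n≡0 n)

0<sg⇔0< : ∀ n → 0 < sg n ⇔ 0 < n
0<sg⇔0< zero    = mk⇔ (λ ()) (λ ())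
0<sg⇔0< (suc n) = mk⇔ (λ _ → z<s) (λ p → subst (0 <_) (sym (sg-pos p)) z<s)

sg≤1 : ∀ n → sg n ≤ 1
sg≤1 n = m∸n≤m 1 (1 ∸ n)

χ≡ : ℕ → ℕ → ℕ
χ≡ m n = 1 ∸ ((m ∸ n) + (n ∸ m))

0<χ≡⇒≡ : ∀ m n → 0 < χ≡ m n → m ≡ n
0<χ≡⇒≡ zero    zero    _ = refl
0<χ≡⇒≡ (suc m) (suc n) p = cong suc (0<χ≡⇒≡ m n p)
0<χ≡⇒≡ zero    (suc n) p = contradiction (0<1∸n⇒n≡0 (suc n) p) λ ()
0<χ≡⇒≡ (suc m) zero    p = contradiction (0<1∸n⇒n≡0 (suc m + 0) p) λ ()

0<χ≡-refl : ∀ {m n} → m ≡ n → 0 < χ≡ m n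
0<χ≡-refl {zero}  refl = z<s
0<χ≡-refl {suc m} refl = 0<χ≡-refl {m} refl

0<Σ<⇒ : ∀ k f → 0 < Σ< k f → Σ ℕ λ i → i < k × 0 < f i
0<Σ<⇒ (suc k) f p with 0<m+n⇒0<m⊎0<n (Σ< k f) (f k) p
... | inj₁ q = let i , i<k , fi = 0<Σ<⇒ k f q in i , m<n⇒m<1+n i<k , fi
... | inj₂ q = k , ≤-refl , q

0<⇒0<Σ< : ∀ {k} f {i} → i < k → 0 < f i → 0 < Σ< k f
0<⇒0<Σ< {suc k} f {i} i<1+k p with m<1+n⇒m<n∨m≡n i<1+k
... | inj₁ i<k  = 0<m⇒0<m+n (f k) (0<⇒0<Σ< f i<k p)
... | inj₂ refl = 0<n⇒0<m+n (Σ< k f) p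


quotRem-unique : ∀ m q r q′ r′ → r < m → r′ < m → q * m + r ≡ q′ * m + r′ → q ≡ q′ × r ≡ r′
quotRem-unique m zero    r zero     r′ _ _ e = refl , e
quotRem-unique m zero    r (suc q′) r′ r<m _ e =
  contradiction (≤-trans (m≤m+n m (q′ * m)) (m≤m+n _ r′)) (<⇒≱ (subst (_< m) e r<m))
quotRem-unique m (suc q) r zero     r′ _ r′<m e =
  contradiction (≤-trans (m≤m+n m (q * m)) (m≤m+n _ r)) (<⇒≱ (subst (_< m) (sym e) r′<m))
quotRem-unique m (suc q) r (suc q′) r′ r<m r′<m e =
  let q≡q′ , r≡r′ = quotRem-unique m q r q′ r′ r<m r′<m
                      (+-cancelˡ-≡ m _ _ (trans (sym (+-assoc m (q * m) r)) (trans e (+-assoc m (q′ * m) r′))))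
  in cong suc q≡q′ , r≡r′

IsDigit : ℕ → ℕ → ℕ → ℕ → Set
IsDigit u n x d = Σ ℕ λ q → Σ ℕ λ r → r < n ^ x × u ≡ (q * n + d) * n ^ x + r

IsDigit-unique : ∀ u n x {d d′} → d < n → d′ < n → IsDigit u n x d → IsDigit u n x d′ → d ≡ d′
IsDigit-unique u n x {d} {d′} d<n d′<n (q , r , r< , e) (q′ , r′ , r′< , e′) =
  proj₂ (quotRem-unique n q d q′ d′ d<n d′<n
          (proj₁ (quotRem-unique (n ^ x) (q * n + d) r (q′ * n + d′) r′ r< r′< (trans (sym e) e′))))

digit : ℕ → (n : ℕ) → .{{NonZero n}} → ℕ → ℕ
digit u n x = u / n ^ x % n
  where instance _ = m^n≢0 n x

digit< : ∀ u n x .{{_ : NonZero n}} → digit u n x < n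
digit< u n x = m%n<n _ n

digit-isDigit : ∀ u n x .{{_ : NonZero n}} → IsDigit u n x (digit u n x)
digit-isDigit u n x = Q / n , u % n ^ x , m%n<n u (n ^ x) , (begin
    u                                        ≡⟨ m≡m%n+[m/n]*n u (n ^ x) ⟩
    u % n ^ x + Q * n ^ x                    ≡⟨ cong (λ q → u % n ^ x + q * n ^ x) (m≡m%n+[m/n]*n Q n) ⟩
    u % n ^ x + (Q % n + Q / n * n) * n ^ x  ≡⟨ shuffle (u % n ^ x) (Q % n) (Q / n * n) (n ^ x) ⟩
    (Q / n * n + Q % n) * n ^ x + u % n ^ x  ∎)
  where
  instance _ = m^n≢0 n x
  Q = u / n ^ x
  open ≡-Reasoning
  shuffle : ∀ a b c d → a + (b + c) * d ≡ (c + b) * d + a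
  shuffle = solve-∀

fromDigits : ℕ → (ℕ → ℕ) → ℕ → ℕ
fromDigits m b k = Σ< k (λ j → m ^ j * b j)

fromDigits< : ∀ m b k → (∀ j → j < k → b j < m) → fromDigits m b k < m ^ k
fromDigits< m b zero    _ = z<s
fromDigits< m b (suc k) h = begin-strict
    fromDigits m b k + m ^ k * b k  <⟨ +-monoˡ-< (m ^ k * b k) (fromDigits< m b k (λ j j<k → h j (m<n⇒m<1+n j<k))) ⟩
    m ^ k + m ^ k * b k             ≡⟨ sym (*-suc (m ^ k) (b k)) ⟩
    m ^ k * suc (b k)               ≤⟨ *-monoʳ-≤ (m ^ k) (h k ≤-refl) ⟩
    m ^ k * m                       ≡⟨ *-comm (m ^ k) m ⟩
    m ^ suc k                       ∎
  where open ≤-Reasoning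

fromDigits-isDigit : ∀ m b k j → (∀ i → i < k → b i < m) → j < k → IsDigit (fromDigits m b k) m j (b j)
fromDigits-isDigit m b (suc k) j h j<1+k with m<1+n⇒m<n∨m≡n j<1+k
... | inj₂ refl = 0 , fromDigits m b j , fromDigits< m b j (λ i i<j → h i (m<n⇒m<1+n i<j)) ,
                  trans (+-comm _ (m ^ j * b j)) (cong (_+ fromDigits m b j) (*-comm (m ^ j) (b j)))
... | inj₁ j<k with fromDigits-isDigit m b k j (λ i i<k → h i (m<n⇒m<1+n i<k)) j<k | m≤n⇒∃[o]m+o≡n j<k
... | q , r , r< , e | t , refl = q + m ^ t * b (suc j + t) , r , r< , (begin
    fromDigits m b (suc j + t) + m ^ (suc j + t) * b (suc j + t)
      ≡⟨ cong₂ _+_ e (cong (_* b (suc j + t)) (^-distribˡ-+-* m (suc j) t)) ⟩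
    (q * m + b j) * m ^ j + r + m * m ^ j * m ^ t * b (suc j + t)
      ≡⟨ carry q m (b j) (m ^ j) r (m ^ t) (b (suc j + t)) ⟩
    ((q + m ^ t * b (suc j + t)) * m + b j) * m ^ j + r ∎)
  where
  open ≡-Reasoning
  carry : ∀ q m bj mj r mt bk → (q * m + bj) * mj + r + m * mj * mt * bk ≡ ((q + mt * bk) * m + bj) * mj + r
  carry = solve-∀

fromDigits-isDigit-0 : ∀ m b k j .{{_ : NonZero m}} → (∀ i → i < k → b i < m) → k ≤ j →
                       IsDigit (fromDigits m b k) m j 0
fromDigits-isDigit-0 m b k j h k≤j =
  0 , fromDigits m b k , <-≤-trans (fromDigits< m b k h) (^-monoʳ-≤ m k≤j) , sym (+-identityˡ _)

digit-fromDigits : ∀ m b k j .{{_ : NonZero m}} → (∀ i → i < k → b i < m) → j < k →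
                   digit (fromDigits m b k) m j ≡ b j
digit-fromDigits m b k j h j<k =
  IsDigit-unique _ m j (digit< _ m j) (h j j<k) (digit-isDigit _ m j) (fromDigits-isDigit m b k j h j<k)


n≤tri : ∀ n → n ≤ tri n
n≤tri zero    = z≤n
n≤tri (suc n) = s≤s (m≤m+n n (tri n))

tri-mono-≤ : ∀ {m n} → m ≤ n → tri m ≤ tri n
tri-mono-≤ {zero}          _         = z≤n
tri-mono-≤ {suc m} {suc n} (s≤s m≤n) = s≤s (+-mono-≤ m≤n (tri-mono-≤ m≤n))

m≤pair : ∀ m n → m ≤ pair m n
m≤pair m n = ≤-trans (m≤m+n m n) (≤-trans (n≤tri (m + n)) (m≤m+n (tri (m + n)) n))

n≤pair : ∀ m n → n ≤ pair m n
n≤pair m n = m≤n+m n (tri (m + n))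

pair-<-diagonal : ∀ a b c d → a + b < c + d → pair a b < pair c d
pair-<-diagonal a b c d a+b<c+d = begin-strict
    tri (a + b) + b              ≤⟨ +-monoʳ-≤ (tri (a + b)) (m≤n+m b a) ⟩
    tri (a + b) + (a + b)        <⟨ n<1+n _ ⟩
    suc (tri (a + b) + (a + b))  ≡⟨ cong suc (+-comm (tri (a + b)) (a + b)) ⟩
    tri (suc (a + b))            ≤⟨ tri-mono-≤ a+b<c+d ⟩
    tri (c + d)                  ≤⟨ m≤m+n _ d ⟩
    tri (c + d) + d              ∎
  where open ≤-Reasoning

pair-injective : ∀ a b c d → pair a b ≡ pair c d → a ≡ c × b ≡ d
pair-injective a b c d e with <-cmp (a + b) (c + d)
... | tri< lt _ _ = contradiction e (<⇒≢ (pair-<-diagonal a b c d lt))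
... | tri> _ _ gt = contradiction (sym e) (<⇒≢ (pair-<-diagonal c d a b gt))
... | tri≈ _ a+b≡c+d _ = +-cancelʳ-≡ b a c (trans a+b≡c+d (cong (c +_) (sym b≡d))) , b≡d
  where
  b≡d : b ≡ d
  b≡d = +-cancelˡ-≡ (tri (a + b)) b d (trans e (cong (λ s → tri s + d) (sym a+b≡c+d)))

n≤r+5*n : ∀ r n → n ≤ r + 5 * n
n≤r+5*n r n = ≤-trans (m≤m+n n (4 * n)) (m≤n+m (5 * n) r)

residue5-unique : ∀ r r′ a b → r < 5 → r′ < 5 → r + 5 * a ≡ r′ + 5 * b → r ≡ r′ × a ≡ b
residue5-unique r r′ a b r<5 r′<5 e =
  let a≡b , r≡r′ = quotRem-unique 5 a r b r′ r<5 r′<5 (begin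
        a * 5 + r   ≡⟨ +-comm (a * 5) r ⟩
        r + a * 5   ≡⟨ cong (r +_) (*-comm a 5) ⟩
        r + 5 * a   ≡⟨ e ⟩
        r′ + 5 * b  ≡⟨ cong (r′ +_) (*-comm 5 b) ⟩
        r′ + b * 5  ≡⟨ +-comm r′ (b * 5) ⟩
        b * 5 + r′  ∎)
  in r≡r′ , a≡b
  where open ≡-Reasoning

fv≤enc : ∀ φ {x} → x ∈ fv φ → x ≤ enc φ
fv≤enc (eq x y)  (here refl)         = ≤-trans (m≤pair x y) (n≤r+5*n 1 _)
fv≤enc (eq x y)  (there (here refl)) = ≤-trans (n≤pair x y) (n≤r+5*n 1 _)
fv≤enc (neg φ)   x∈                  = ≤-trans (fv≤enc φ x∈) (n≤r+5*n 2 _)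
fv≤enc (and φ ψ) x∈ with ∈-++⁻ (fv φ) x∈
... | inj₁ x∈φ = ≤-trans (fv≤enc φ x∈φ) (≤-trans (m≤pair (enc φ) (enc ψ)) (n≤r+5*n 3 _))
... | inj₂ x∈ψ = ≤-trans (fv≤enc ψ x∈ψ) (≤-trans (n≤pair (enc φ) (enc ψ)) (n≤r+5*n 3 _))
fv≤enc (ex y φ)  x∈ =
  ≤-trans (fv≤enc φ (proj₁ (∈-filter⁻ (λ z → ¬? (z ≟ y)) x∈))) (≤-trans (n≤pair y (enc φ)) (n≤r+5*n 4 _))

-- Equality patterns of valuations

record SamePattern {D₁ D₂ : Set} (V : ℕ → Set) (v : ℕ → D₁) (w : ℕ → D₂) : Set where
  constructor same-pattern
  field ≡⇔≡ : ∀ {x y} → V x → V y → (v x ≡ v y) ⇔ (w x ≡ w y)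
open SamePattern

pattern-sym : ∀ {D₁ D₂ : Set} {V} {v : ℕ → D₁} {w : ℕ → D₂} → SamePattern V v w → SamePattern V w v
pattern-sym h = same-pattern λ vx vy → mk⇔ (from (≡⇔≡ h vx vy)) (to (≡⇔≡ h vx vy))

pattern-trans : ∀ {D₁ D₂ D₃ : Set} {V} {u : ℕ → D₁} {v : ℕ → D₂} {w : ℕ → D₃} →
                SamePattern V u v → SamePattern V v w → SamePattern V u w
pattern-trans g h = same-pattern λ vx vy →
  mk⇔ (to (≡⇔≡ h vx vy) ∘ to (≡⇔≡ g vx vy)) (from (≡⇔≡ g vx vy) ∘ from (≡⇔≡ h vx vy))

pattern-∘ : ∀ {D₁ D₂ : Set} {V} {f : D₁ → D₂} → Injective _≡_ _≡_ f → (v : ℕ → D₁) →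
            SamePattern V v (f ∘ v)
pattern-∘ {f = f} f-inj v = same-pattern λ _ _ → mk⇔ (cong f) f-inj

pattern-≗ : ∀ {D : Set} {V : ℕ → Set} {v w : ℕ → D} → (∀ {x} → V x → v x ≡ w x) → SamePattern V v w
pattern-≗ v≗w = same-pattern λ vx vy →
  mk⇔ (λ e → trans (sym (v≗w vx)) (trans e (v≗w vy))) (λ e → trans (v≗w vx) (trans e (sym (v≗w vy))))

toℕ-pattern : ∀ {V : ℕ → Set} {n} {f : ℕ → ℕ} {w : ℕ → Fin n} →
              (∀ {x} → V x → toℕ (w x) ≡ f x) → SamePattern V f w
toℕ-pattern {w = w} toℕ∘w≗f =
  pattern-trans (pattern-≗ (sym ∘ toℕ∘w≗f)) (pattern-sym (pattern-∘ toℕ-injective w))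

sat-pattern : ∀ {D₁ D₂ : Set} {V : ℕ → Set} {v : ℕ → D₁} {w : ℕ → D₂} φ → QF φ →
              (∀ {x} → x ∈ fv φ → V x) → SamePattern V v w → sat D₁ v φ ⇔ sat D₂ w φ
sat-pattern top       _         _    _ = mk⇔ _ _
sat-pattern (eq x y)  _         fv⊆V h = ≡⇔≡ h (fv⊆V (here refl)) (fv⊆V (there (here refl)))
sat-pattern (neg φ)   qf        fv⊆V h = →-cong-⇔ (sat-pattern φ qf fv⊆V h) ⇔-refl
sat-pattern (and φ ψ) (qφ , qψ) fv⊆V h =
  sat-pattern φ qφ (fv⊆V ∘ ∈-++⁺ˡ) h ×-⇔ sat-pattern ψ qψ (fv⊆V ∘ ∈-++⁺ʳ (fv φ)) h

update-cong : ∀ {D : Set} {v w : ℕ → D} x d {y} → (y ≢ x → v y ≡ w y) → update v x d y ≡ update w x d y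
update-cong x d {y} h with y ≟ x
... | yes _   = refl
... | no y≢x  = h y≢x

sat-agree : ∀ {D : Set} {v w : ℕ → D} φ → (∀ {x} → x ∈ fv φ → v x ≡ w x) → sat D v φ → sat D w φ
sat-agree top       _ _ = tt
sat-agree (eq x y)  h s = trans (sym (h (here refl))) (trans s (h (there (here refl))))
sat-agree (neg φ)   h ¬s = ¬s ∘ sat-agree φ (sym ∘ h)
sat-agree (and φ ψ) h (s , t) = sat-agree φ (h ∘ ∈-++⁺ˡ) s , sat-agree ψ (h ∘ ∈-++⁺ʳ (fv φ)) t
sat-agree (ex x φ)  h (d , s) =
  d , sat-agree φ (λ y∈ → update-cong x d (λ y≢x → h (∈-filter⁺ (λ z → ¬? (z ≟ x)) y∈ y≢x))) s

sentence-sat : ∀ {D : Set} (v w : ℕ → D) ψ → Sentence ψ → sat D v ψ → sat D w ψ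
sentence-sat v w ψ closed = sat-agree ψ λ x∈ → contradiction (subst (_ ∈_) closed x∈) λ ()

module _ {X : Set} (_≟X_ : DecidableEquality X) where

  -- the least i ≤ k with g i ≡ d, and k if there is none
  firstIndex : (ℕ → X) → X → ℕ → ℕ
  firstIndex g d zero = zero
  firstIndex g d (suc k) with g 0 ≟X d
  ... | yes _ = zero
  ... | no  _ = suc (firstIndex (g ∘ suc) d k)

  firstIndex≤ : ∀ (g : ℕ → X) d k → firstIndex g d k ≤ k
  firstIndex≤ g d zero = z≤n
  firstIndex≤ g d (suc k) with g 0 ≟X d
  ... | yes _ = z≤n
  ... | no  _ = s≤s (firstIndex≤ (g ∘ suc) d k)

  firstIndex-hit : ∀ (g : ℕ → X) d k {i} → i ≤ k → g i ≡ d → g (firstIndex g d k) ≡ d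
  firstIndex-hit g d zero    z≤n gi≡d = gi≡d
  firstIndex-hit g d (suc k) i≤1+k gi≡d with g 0 ≟X d
  ... | yes g0≡d = g0≡d
  firstIndex-hit g d (suc k) z≤n       gi≡d | no g0≢d = contradiction gi≡d g0≢d
  firstIndex-hit g d (suc k) (s≤s i≤k) gi≡d | no _    = firstIndex-hit (g ∘ suc) d k i≤k gi≡d

  representative : (ℕ → X) → ℕ → ℕ → ℕ
  representative g B x = firstIndex g (g x) B

  representative≤ : ∀ (g : ℕ → X) B x → representative g B x ≤ B
  representative≤ g B x = firstIndex≤ g (g x) B

  representative-pattern : ∀ (g : ℕ → X) B → SamePattern (_≤ B) g (representative g B)
  representative-pattern g B = same-pattern λ {x} {y} x≤B y≤B → mk⇔ (cong (λ d → firstIndex g d B)) λ e →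
    trans (sym (firstIndex-hit g (g x) B x≤B refl)) (trans (cong g e) (firstIndex-hit g (g y) B y≤B refl))

SatIn : ℕ → Fm → Set
SatIn n φ = Σ (ℕ → Fin n) λ w → sat (Fin n) w φ

sat⇒SatIn : ∀ {X : Set} → DecidableEquality X → {g : ℕ → X} → ∀ φ → QF φ → sat X g φ →
            ∀ {m} → enc φ < m → SatIn m φ
sat⇒SatIn _≟X_ {g} φ qf s {m} enc<m =
  w , to (sat-pattern φ qf (fv≤enc φ) g~w) s
  where
  w : ℕ → Fin m
  w x = fromℕ< (≤-<-trans (representative≤ _≟X_ g (enc φ) x) enc<m)
  g~w : SamePattern (_≤ enc φ) g w
  g~w = pattern-trans (representative-pattern _≟X_ g (enc φ)) (toℕ-pattern λ _ → toℕ-fromℕ< _)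

-- Deciding satisfiability of a quantifier-free formula in a finite domain from its code

sgᴱ notᴱ : ∀ {n} → Exp n → Exp n
sgᴱ  e = monus (lit 1) (monus (lit 1) e)
notᴱ e = monus (lit 1) e

χ≡ᴱ : ∀ {n} → Exp n → Exp n → Exp n
χ≡ᴱ a b = monus (lit 1) (add (monus a b) (monus b a))

pairᴱ : Exp 2
pairᴱ = add (rec (add (var (# 0)) (var (# 1))) (lit 0) (add (add (lit 1) (var (# 0))) (var (# 1)))) (var (# 1))

pairᴺ : ℕ → ℕ → ℕ
pairᴺ a b = ⟦ pairᴱ ⟧ (a ∷ b ∷ [])

pairᴺ≡pair : ∀ a b → pairᴺ a b ≡ pair a b
pairᴺ≡pair a b = cong (_+ b) (tri-iterate (a + b))
  where
  tri-iterate : ∀ k → iterate k 0 (λ i t → 1 + i + t) ≡ tri k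
  tri-iterate zero    = refl
  tri-iterate (suc k) = cong (suc k +_) (tri-iterate k)

-- A bounded search for the q ≤ u and r < n ^ x of IsDigit.
isDigitᴱ : Exp 4
isDigitᴱ = bsum (add (var (# 0)) (lit 1)) (bsum (pow (var (# 2)) (var (# 3)))
             (χ≡ᴱ (var (# 2)) (add (mul (add (mul (var (# 1)) (var (# 3))) (var (# 5))) (pow (var (# 3)) (var (# 4))))
                                   (var (# 0)))))

isDigitᴺ : ℕ → ℕ → ℕ → ℕ → ℕ
isDigitᴺ u n x d = ⟦ isDigitᴱ ⟧ (u ∷ n ∷ x ∷ d ∷ [])

isDigitᴺ-sound : ∀ u n x d → 0 < isDigitᴺ u n x d → IsDigit u n x d
isDigitᴺ-sound u n x d p =
  let q , _ , p′ = 0<Σ<⇒ (u + 1) _ p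
      r , r< , p″ = 0<Σ<⇒ (n ^ x) _ p′
  in q , r , r< , 0<χ≡⇒≡ u _ p″

isDigitᴺ-complete : ∀ u n x d .{{_ : NonZero n}} → IsDigit u n x d → 0 < isDigitᴺ u n x d
isDigitᴺ-complete u n x d (q , r , r< , e) =
  0<⇒0<Σ< _ q<u+1 (0<⇒0<Σ< (λ r → χ≡ u ((q * n + d) * n ^ x + r)) r< (0<χ≡-refl e))
  where
  q<u+1 : q < u + 1
  q<u+1 = begin-strict
    q                            ≤⟨ m≤m*n q n ⟩
    q * n                        ≤⟨ m≤m+n _ d ⟩
    q * n + d                    ≤⟨ m≤m*n (q * n + d) (n ^ x) {{m^n≢0 n x}} ⟩
    (q * n + d) * n ^ x          ≤⟨ m≤m+n _ r ⟩
    (q * n + d) * n ^ x + r      ≡⟨ e ⟨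
    u                            <⟨ m<m+n u z<s ⟩
    u + 1                        ∎
    where open ≤-Reasoning

sameDigitᴱ : Exp 4
sameDigitᴱ = bsum (var (# 1)) (mul (call isDigitᴱ (var (# 1) ∷ var (# 2) ∷ var (# 3) ∷ var (# 0) ∷ []))
                                   (call isDigitᴱ (var (# 1) ∷ var (# 2) ∷ var (# 4) ∷ var (# 0) ∷ [])))

sameDigitᴺ : ℕ → ℕ → ℕ → ℕ → ℕ
sameDigitᴺ u n x y = ⟦ sameDigitᴱ ⟧ (u ∷ n ∷ x ∷ y ∷ [])

sameDigitᴺ-correct : ∀ u n x y .{{_ : NonZero n}} → 0 < sameDigitᴺ u n x y ⇔ digit u n x ≡ digit u n y
sameDigitᴺ-correct u n x y = mk⇔ sound complete
  where
  digit-of : ∀ z {d} → d < n → 0 < isDigitᴺ u n z d → digit u n z ≡ d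
  digit-of z d<n p = IsDigit-unique u n z (digit< u n z) d<n (digit-isDigit u n z) (isDigitᴺ-sound u n z _ p)
  sound : 0 < sameDigitᴺ u n x y → digit u n x ≡ digit u n y
  sound p = let d , d<n , p′ = 0<Σ<⇒ n _ p
                px , py = 0<m*n⇒0<m×0<n (isDigitᴺ u n x d) _ p′
            in trans (digit-of x d<n px) (sym (digit-of y d<n py))
  complete : digit u n x ≡ digit u n y → 0 < sameDigitᴺ u n x y
  complete e = 0<⇒0<Σ< _ (digit< u n x) (0<m⇒0<n⇒0<m*n
    (isDigitᴺ-complete u n x _ (digit-isDigit u n x))
    (isDigitᴺ-complete u n y _ (subst (IsDigit u n y) (sym e) (digit-isDigit u n y))))

bitᴺ : ℕ → ℕ → ℕ
bitᴺ T j = isDigitᴺ T 2 j 1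

bit-fromDigits : ∀ b k {j} → (∀ i → b i < 2) → j < k → 0 < bitᴺ (fromDigits 2 b k) j ⇔ 0 < b j
bit-fromDigits b k {j} b<2 j<k = mk⇔
  (λ p → subst (0 <_) (IsDigit-unique _ 2 j (s<s z<s) (b<2 j) (isDigitᴺ-sound _ 2 j 1 p) digit-j) z<s)
  (λ p → isDigitᴺ-complete _ 2 j 1 (subst (IsDigit _ 2 j) (≤-antisym (≤-pred (b<2 j)) p) digit-j))
  where
  digit-j : IsDigit (fromDigits 2 b k) 2 j (b j)
  digit-j = fromDigits-isDigit 2 b k j (λ i _ → b<2 i) j<k

bit-fromDigits-beyond : ∀ b k {j} → (∀ i → b i < 2) → k ≤ j → ¬ 0 < bitᴺ (fromDigits 2 b k) j
bit-fromDigits-beyond b k {j} b<2 k≤j p =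
  contradiction (IsDigit-unique _ 2 j (s<s z<s) z<s (isDigitᴺ-sound _ 2 j 1 p)
                                (fromDigits-isDigit-0 2 b k j (λ i _ → b<2 i) k≤j)) λ ()


bitᴱ : ∀ {n} → Exp n → Exp n → Exp n
bitᴱ T j = call isDigitᴱ (T ∷ lit 2 ∷ j ∷ lit 1 ∷ [])

-- The truth value of the formula coded j, read off a table T of the truth values of all codes below j.
stepᴱ : Exp 4
stepᴱ = sgᴱ (add (add (add
  (χ≡ᴱ (var (# 0)) (lit 0))
  (bsum (add (lit 1) (var (# 0))) (bsum (add (lit 1) (var (# 1)))
    (mul (χ≡ᴱ (var (# 2)) (add (lit 1) (mul (lit 5) (call pairᴱ (var (# 1) ∷ var (# 0) ∷ [])))))
         (call sameDigitᴱ (var (# 4) ∷ var (# 5) ∷ var (# 1) ∷ var (# 0) ∷ []))))))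
  (bsum (var (# 0))
    (mul (χ≡ᴱ (var (# 1)) (add (lit 2) (mul (lit 5) (var (# 0)))))
         (notᴱ (bitᴱ (var (# 2)) (var (# 0)))))))
  (bsum (var (# 0)) (bsum (var (# 1))
    (mul (χ≡ᴱ (var (# 2)) (add (lit 3) (mul (lit 5) (call pairᴱ (var (# 1) ∷ var (# 0) ∷ [])))))
         (mul (bitᴱ (var (# 3)) (var (# 1))) (bitᴱ (var (# 3)) (var (# 0))))))))

eqCase : ℕ → ℕ → ℕ → ℕ
eqCase j u n = Σ< (suc j) λ x → Σ< (suc j) λ y → χ≡ j (1 + 5 * pairᴺ x y) * sameDigitᴺ u n x y

negCase : ℕ → ℕ → ℕ
negCase j T = Σ< j λ a → χ≡ j (2 + 5 * a) * (1 ∸ bitᴺ T a)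

andCase : ℕ → ℕ → ℕ
andCase j T = Σ< j λ a → Σ< j λ b → χ≡ j (3 + 5 * pairᴺ a b) * (bitᴺ T a * bitᴺ T b)

stepSum : ℕ → ℕ → ℕ → ℕ → ℕ
stepSum j T u n = χ≡ j 0 + eqCase j u n + negCase j T + andCase j T

opaque
  stepᴺ : ℕ → ℕ → ℕ → ℕ → ℕ
  stepᴺ j T u n = ⟦ stepᴱ ⟧ (j ∷ T ∷ u ∷ n ∷ [])

  stepᴺ≡sg : ∀ j T u n → stepᴺ j T u n ≡ sg (stepSum j T u n)
  stepᴺ≡sg j T u n = refl

data StepCase (j T u n : ℕ) : Set where
  top-case : j ≡ 0 → StepCase j T u n
  eq-case  : ∀ x y → j ≡ 1 + 5 * pair x y → 0 < sameDigitᴺ u n x y → StepCase j T u n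
  neg-case : ∀ a → j ≡ 2 + 5 * a → ¬ 0 < bitᴺ T a → StepCase j T u n
  and-case : ∀ a b → j ≡ 3 + 5 * pair a b → 0 < bitᴺ T a → 0 < bitᴺ T b → StepCase j T u n

stepSum-cases : ∀ j T u n → 0 < stepSum j T u n → StepCase j T u n
stepSum-cases j T u n p with 0<m+n⇒0<m⊎0<n (χ≡ j 0 + eqCase j u n + negCase j T) (andCase j T) p
... | inj₂ p∧ =
  let a , _ , p′ = 0<Σ<⇒ j _ p∧
      b , _ , p″ = 0<Σ<⇒ j _ p′
      e , bits = 0<m*n⇒0<m×0<n (χ≡ j (3 + 5 * pairᴺ a b)) _ p″
      ba , bb = 0<m*n⇒0<m×0<n (bitᴺ T a) (bitᴺ T b) bits
  in and-case a b (trans (0<χ≡⇒≡ j _ e) (cong (λ c → 3 + 5 * c) (pairᴺ≡pair a b))) ba bb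
... | inj₁ p′ with 0<m+n⇒0<m⊎0<n (χ≡ j 0 + eqCase j u n) (negCase j T) p′
... | inj₂ p¬ =
  let a , _ , p″ = 0<Σ<⇒ j _ p¬
      e , nb = 0<m*n⇒0<m×0<n (χ≡ j (2 + 5 * a)) _ p″
  in neg-case a (0<χ≡⇒≡ j _ e) (to (0<1∸n⇔¬0<n _) nb)
... | inj₁ p″ with 0<m+n⇒0<m⊎0<n (χ≡ j 0) (eqCase j u n) p″
... | inj₁ p⊤ = top-case (0<χ≡⇒≡ j 0 p⊤)
... | inj₂ p≡ =
  let x , _ , p‴ = 0<Σ<⇒ (suc j) _ p≡
      y , _ , p⁗ = 0<Σ<⇒ (suc j) _ p‴
      e , same = 0<m*n⇒0<m×0<n (χ≡ j (1 + 5 * pairᴺ x y)) _ p⁗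
  in eq-case x y (trans (0<χ≡⇒≡ j _ e) (cong (λ c → 1 + 5 * c) (pairᴺ≡pair x y))) same

stepSum-top : ∀ T u n → 0 < stepSum 0 T u n
stepSum-top T u n = 0<m⇒0<m+n (andCase 0 T) (0<m⇒0<m+n (negCase 0 T) (0<m⇒0<m+n (eqCase 0 u n) z<s))

stepSum-eq : ∀ x y T u n → 0 < stepSum (1 + 5 * pair x y) T u n ⇔ 0 < sameDigitᴺ u n x y
stepSum-eq x y T u n = mk⇔ (sound ∘ stepSum-cases j T u n) complete
  where
  j = 1 + 5 * pair x y
  sound : StepCase j T u n → 0 < sameDigitᴺ u n x y
  sound (top-case ())
  sound (eq-case x′ y′ e same) with residue5-unique 1 1 (pair x y) (pair x′ y′) (s<s z<s) (s<s z<s) e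
  ...   | _ , e′ with pair-injective x y x′ y′ e′
  ...     | refl , refl = same
  sound (neg-case a e _) with residue5-unique 1 2 (pair x y) a (s<s z<s) (s<s (s<s z<s)) e
  ... | () , _
  sound (and-case a b e _ _) with residue5-unique 1 3 (pair x y) (pair a b) (s<s z<s) (s<s (s<s (s<s z<s))) e
  ... | () , _
  complete : 0 < sameDigitᴺ u n x y → 0 < stepSum j T u n
  complete same = 0<m⇒0<m+n _ (0<m⇒0<m+n _ (0<n⇒0<m+n (χ≡ j 0)
    (0<⇒0<Σ< _ (s≤s (≤-trans (m≤pair x y) (n≤r+5*n 1 _))) (0<⇒0<Σ< _ (s≤s (≤-trans (n≤pair x y) (n≤r+5*n 1 _)))
      (0<m⇒0<n⇒0<m*n (0<χ≡-refl (cong (λ c → 1 + 5 * c) (sym (pairᴺ≡pair x y)))) same)))))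

stepSum-neg : ∀ a T u n → 0 < stepSum (2 + 5 * a) T u n ⇔ (¬ 0 < bitᴺ T a)
stepSum-neg a T u n = mk⇔ (sound ∘ stepSum-cases j T u n) complete
  where
  j = 2 + 5 * a
  sound : StepCase j T u n → ¬ 0 < bitᴺ T a
  sound (top-case ())
  sound (eq-case x y e _) with residue5-unique 2 1 a (pair x y) (s<s (s<s z<s)) (s<s z<s) e
  ...   | () , _
  sound (neg-case a′ e ¬bit) with residue5-unique 2 2 a a′ (s<s (s<s z<s)) (s<s (s<s z<s)) e
  ... | _ , refl = ¬bit
  sound (and-case a′ b e _ _) with residue5-unique 2 3 a (pair a′ b) (s<s (s<s z<s)) (s<s (s<s (s<s z<s))) e
  ... | () , _
  complete : ¬ 0 < bitᴺ T a → 0 < stepSum j T u n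
  complete ¬bit = 0<m⇒0<m+n _ (0<n⇒0<m+n (χ≡ j 0 + eqCase j u n)
    (0<⇒0<Σ< _ (s≤s (n≤r+5*n 1 a)) (0<m⇒0<n⇒0<m*n (0<χ≡-refl {j} refl) (from (0<1∸n⇔¬0<n _) ¬bit))))

stepSum-and : ∀ a b T u n → 0 < stepSum (3 + 5 * pair a b) T u n ⇔ (0 < bitᴺ T a × 0 < bitᴺ T b)
stepSum-and a b T u n = mk⇔ (sound ∘ stepSum-cases j T u n) complete
  where
  j = 3 + 5 * pair a b
  sound : StepCase j T u n → 0 < bitᴺ T a × 0 < bitᴺ T b
  sound (top-case ())
  sound (eq-case x y e _) with residue5-unique 3 1 (pair a b) (pair x y) (s<s (s<s (s<s z<s))) (s<s z<s) e
  ...   | () , _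
  sound (neg-case a′ e _) with residue5-unique 3 2 (pair a b) a′ (s<s (s<s (s<s z<s))) (s<s (s<s z<s)) e
  ... | () , _
  sound (and-case a′ b′ e ba bb) with residue5-unique 3 3 (pair a b) (pair a′ b′) (s<s (s<s (s<s z<s))) (s<s (s<s (s<s z<s))) e
  ... | _ , e′ with pair-injective a b a′ b′ e′
  ...   | refl , refl = ba , bb
  complete : 0 < bitᴺ T a × 0 < bitᴺ T b → 0 < stepSum j T u n
  complete (ba , bb) = 0<n⇒0<m+n (χ≡ j 0 + eqCase j u n + negCase j T)
    (0<⇒0<Σ< _ (s≤s (≤-trans (m≤pair a b) (n≤r+5*n 2 _))) (0<⇒0<Σ< _ (s≤s (≤-trans (n≤pair a b) (n≤r+5*n 2 _)))
      (0<m⇒0<n⇒0<m*n (0<χ≡-refl (cong (λ c → 3 + 5 * c) (sym (pairᴺ≡pair a b)))) (0<m⇒0<n⇒0<m*n ba bb))))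

tableᴱ : Exp 3
tableᴱ = rec (var (# 0)) (lit 0)
  (add (var (# 1)) (mul (pow (lit 2) (var (# 0))) (call stepᴱ (var (# 0) ∷ var (# 1) ∷ var (# 3) ∷ var (# 4) ∷ []))))

opaque
  unfolding stepᴺ

  tableᴺ : ℕ → ℕ → ℕ → ℕ
  tableᴺ k u n = ⟦ tableᴱ ⟧ (k ∷ u ∷ n ∷ [])

  tableᴺ-suc : ∀ k u n → tableᴺ (suc k) u n ≡ tableᴺ k u n + 2 ^ k * stepᴺ k (tableᴺ k u n) u n
  tableᴺ-suc k u n = refl

-- The truth value of the formula coded j under the valuation given by the base-n digits of u.
truth : ℕ → ℕ → ℕ → ℕ
truth u n j = stepᴺ j (tableᴺ j u n) u n

tableᴺ≡fromDigits : ∀ k u n → tableᴺ k u n ≡ fromDigits 2 (truth u n) k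
tableᴺ≡fromDigits zero    u n = tableᴺ-zero
  where
  opaque
    unfolding tableᴺ
    tableᴺ-zero : tableᴺ 0 u n ≡ 0
    tableᴺ-zero = refl
tableᴺ≡fromDigits (suc k) u n = trans (tableᴺ-suc k u n) (cong (_+ 2 ^ k * truth u n k) (tableᴺ≡fromDigits k u n))

truth-step : ∀ u n j → 0 < truth u n j ⇔ 0 < stepSum j (tableᴺ j u n) u n
truth-step u n j rewrite stepᴺ≡sg j (tableᴺ j u n) u n = 0<sg⇔0< (stepSum j (tableᴺ j u n) u n)

truth<2 : ∀ u n j → truth u n j < 2
truth<2 u n j rewrite stepᴺ≡sg j (tableᴺ j u n) u n = s≤s (sg≤1 (stepSum j (tableᴺ j u n) u n))

bit-table : ∀ u n {j k} → j < k → 0 < bitᴺ (tableᴺ k u n) j ⇔ 0 < truth u n j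
bit-table u n {j} {k} j<k = subst (λ T → 0 < bitᴺ T j ⇔ 0 < truth u n j) (sym (tableᴺ≡fromDigits k u n))
                                  (bit-fromDigits (truth u n) k (truth<2 u n) j<k)

truth-correct : ∀ u n .{{_ : NonZero n}} φ → QF φ → 0 < truth u n (enc φ) ⇔ sat ℕ (digit u n) φ
truth-correct u n top       _ = mk⇔ _ (λ _ → from (truth-step u n 0) (stepSum-top (tableᴺ 0 u n) u n))
truth-correct u n (eq x y)  _ = ⇔-trans (truth-step u n j)
  (⇔-trans (stepSum-eq x y (tableᴺ j u n) u n) (sameDigitᴺ-correct u n x y))
  where j = enc (eq x y)
truth-correct u n (neg φ)   qf = ⇔-trans (truth-step u n j) (⇔-trans (stepSum-neg (enc φ) (tableᴺ j u n) u n)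
  (→-cong-⇔ (⇔-trans (bit-table u n (s≤s (n≤r+5*n 1 _))) (truth-correct u n φ qf)) ⇔-refl))
  where j = enc (neg φ)
truth-correct u n (and φ ψ) (qφ , qψ) =
  ⇔-trans (truth-step u n j) (⇔-trans (stepSum-and (enc φ) (enc ψ) (tableᴺ j u n) u n)
  (⇔-trans (bit-table u n (s≤s (≤-trans (m≤pair (enc φ) (enc ψ)) (n≤r+5*n 2 _)))) (truth-correct u n φ qφ) ×-⇔
   ⇔-trans (bit-table u n (s≤s (≤-trans (n≤pair (enc φ) (enc ψ)) (n≤r+5*n 2 _)))) (truth-correct u n ψ qψ)))
  where j = enc (and φ ψ)

-- The valuations into an n-element domain are enumerated as the numbers u < n ^ (1 + e), read in base n.
satInᴱ : Exp 2
satInᴱ = sgᴱ (bsum (pow (var (# 0)) (add (lit 1) (var (# 1))))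
                   (bitᴱ (call tableᴱ (add (lit 1) (var (# 2)) ∷ var (# 0) ∷ var (# 1) ∷ [])) (var (# 2))))

satisfyingCodes : ℕ → ℕ → ℕ
satisfyingCodes n e = Σ< (n ^ suc e) λ u → bitᴺ (tableᴺ (suc e) u n) e

opaque
  unfolding tableᴺ

  satInᴺ : ℕ → ℕ → ℕ
  satInᴺ n e = ⟦ satInᴱ ⟧ (n ∷ e ∷ [])

  satInᴺ-eval : ∀ n e → ⟦ satInᴱ ⟧ (n ∷ e ∷ []) ≡ satInᴺ n e
  satInᴺ-eval n e = refl

  satInᴺ≡sg : ∀ n e → satInᴺ n e ≡ sg (satisfyingCodes n e)
  satInᴺ≡sg n e = refl

satInᴺ≤1 : ∀ n e → satInᴺ n e ≤ 1
satInᴺ≤1 n e rewrite satInᴺ≡sg n e = sg≤1 (satisfyingCodes n e)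

satisfyingCodes⇔SatIn : ∀ n φ → QF φ → 0 < satisfyingCodes n (enc φ) ⇔ SatIn n φ
satisfyingCodes⇔SatIn zero      φ _  = mk⇔ (λ ()) (λ (w , _) → case w 0 of λ ())
satisfyingCodes⇔SatIn n@(suc _) φ qf = mk⇔ sound complete
  where
  e = enc φ
  sound : 0 < satisfyingCodes n e → SatIn n φ
  sound p =
    let u , _ , bit>0 = 0<Σ<⇒ (n ^ suc e) _ p
        w : ℕ → Fin n
        w x = fromℕ< (digit< u n x)
    in w , to (sat-pattern φ qf (fv≤enc φ) (toℕ-pattern λ _ → toℕ-fromℕ< _))
              (to (truth-correct u n φ qf) (to (bit-table u n ≤-refl) bit>0))
  complete : SatIn n φ → 0 < satisfyingCodes n e
  complete (w , s) = 0<⇒0<Σ< _ u< (from (bit-table u n ≤-refl) (from (truth-correct u n φ qf) s′))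
    where
    b = toℕ ∘ w
    b<n : ∀ x → x < suc e → b x < n
    b<n x _ = toℕ<n (w x)
    u = fromDigits n b (suc e)
    u< : u < n ^ suc e
    u< = fromDigits< n b (suc e) b<n
    s′ : sat ℕ (digit u n) φ
    s′ = from (sat-pattern φ qf (fv≤enc φ) (toℕ-pattern λ x≤e → sym (digit-fromDigits n b (suc e) _ b<n (s≤s x≤e))))
              s

satInᴺ-correct : ∀ n φ → QF φ → 0 < satInᴺ n (enc φ) ⇔ SatIn n φ
satInᴺ-correct n φ qf rewrite satInᴺ≡sg n (enc φ) =
  ⇔-trans (0<sg⇔0< (satisfyingCodes n (enc φ))) (satisfyingCodes⇔SatIn n φ qf)

ModelOfSize : (Fm → Set) → ℕ → Set₁
ModelOfSize Γ n = Σ Interp λ A → TInterp Γ A × (D A ↔ Fin n)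

↔-to-injective : ∀ {A B : Set} (iso : A ↔ B) → Injective _≡_ _≡_ (Inverse.to iso)
↔-to-injective iso = Injection.injective (↔⇒↣ iso)

↔-decidableEquality : ∀ {A : Set} {n} → A ↔ Fin n → DecidableEquality A
↔-decidableEquality iso = via-injection (↔⇒↣ iso) Fin._≟_

Spec⇔ : ∀ Γ → (∀ ψ → Γ ψ → Sentence ψ) → ∀ φ → QF φ → ∀ n →
        Spec Γ φ n ⇔ (ModelOfSize Γ n × SatIn n φ)
Spec⇔ Γ sentences φ qf n = mk⇔
  (λ (A , ⊨Γ , ⊨φ , iso) → (A , ⊨Γ , iso) ,
     Inverse.to iso ∘ val A , to (sat-pattern {V = λ _ → ⊤} φ qf _ (pattern-∘ (↔-to-injective iso) (val A))) ⊨φ)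
  (λ ((A , ⊨Γ , iso) , w , s) →
     let A′ = record { D = D A ; val = Inverse.from iso ∘ w } in
     A′ , (λ ψ ψ∈Γ → sentence-sat (val A) (val A′) ψ (sentences ψ ψ∈Γ) (⊨Γ ψ ψ∈Γ)) ,
     to (sat-pattern {V = λ _ → ⊤} φ qf _ (pattern-∘ (↔-to-injective (↔-sym iso)) w)) s , iso)

-- Unbounded finite models yield a model on ℕ (an Ehrenfeucht–Fraïssé argument)

depth : Fm → ℕ
depth top       = 0
depth (eq _ _)  = 0
depth (neg φ)   = depth φ
depth (and φ ψ) = depth φ ⊔ depth ψ
depth (ex _ φ)  = suc (depth φ)

AtLeast : Set → ℕ → Set
AtLeast D k = ∀ (l : List D) → length l < k → Σ D (_∉ l)

AtLeast-mono : ∀ {D k k′} → k ≤ k′ → AtLeast D k′ → AtLeast D k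
AtLeast-mono k≤k′ big l l< = big l (<-≤-trans l< k≤k′)

AtLeast-ℕ : ∀ k → AtLeast ℕ k
AtLeast-ℕ k l _ = suc (sum l) , λ ∈l → <-irrefl refl (∈⇒≤sum ∈l)
  where
  ∈⇒≤sum : ∀ {x l} → x ∈ l → x ≤ sum l
  ∈⇒≤sum {l = y ∷ l} (here refl) = m≤m+n y (sum l)
  ∈⇒≤sum {l = y ∷ l} (there x∈) = ≤-trans (∈⇒≤sum x∈) (m≤n+m (sum l) y)

AtLeast-↔Fin : ∀ {D : Set} {n} → D ↔ Fin n → AtLeast D n
AtLeast-↔Fin {D} {n} iso l l<n = fresh (all? (λ i → any? (from′ i ≟D_) l))
  where
  _≟D_ = ↔-decidableEquality iso
  from′ = Inverse.from iso
  open ≡-Reasoning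
  fresh : Dec (∀ i → from′ i ∈ l) → Σ D (_∉ l)
  fresh (no ¬covered) = let i , i∉l = ¬∀⟶∃¬ n _ (λ i → any? (from′ i ≟D_) l) ¬covered in from′ i , i∉l
  fresh (yes covered) =
    let i , j , i<j , same-index = pigeonhole l<n (index ∘ covered)
    in contradiction (↔-to-injective (↔-sym iso) (begin
         from′ i                                ≡⟨ lookup-index (covered i) ⟩
         Data.List.lookup l (index (covered i)) ≡⟨ cong (Data.List.lookup l) same-index ⟩
         Data.List.lookup l (index (covered j)) ≡⟨ lookup-index (covered j) ⟨
         from′ j                                ∎))
       (Data.Fin.Properties.<⇒≢ i<j)

update-pattern : ∀ {D₁ D₂ : Set} {L} {v₁ : ℕ → D₁} {v₂ : ℕ → D₂} x {d₁ d₂} →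
  (∀ {z} → z ∈ L → z ≢ x → (d₁ ≡ v₁ z) ⇔ (d₂ ≡ v₂ z)) →
  SamePattern (_∈ L) v₁ v₂ → SamePattern (_∈ x ∷ L) (update v₁ x d₁) (update v₂ x d₂)
update-pattern {L = L} {v₁} {v₂} x {d₁} {d₂} fresh h = same-pattern cases
  where
  ∈L : ∀ {z} → z ∈ x ∷ L → z ≢ x → z ∈ L
  ∈L (here z≡x) z≢x = contradiction z≡x z≢x
  ∈L (there z∈) _   = z∈
  cases : ∀ {z z′} → z ∈ x ∷ L → z′ ∈ x ∷ L →
          (update v₁ x d₁ z ≡ update v₁ x d₁ z′) ⇔ (update v₂ x d₂ z ≡ update v₂ x d₂ z′)
  cases {z} {z′} z∈ z′∈ with z ≟ x | z′ ≟ x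
  ... | yes refl | yes refl = mk⇔ (λ _ → refl) (λ _ → refl)
  ... | yes refl | no z′≢x  = fresh (∈L z′∈ z′≢x) z′≢x
  ... | no z≢x   | yes refl = let d⇔ = fresh (∈L z∈ z≢x) z≢x in mk⇔ (sym ∘ to d⇔ ∘ sym) (sym ∘ from d⇔ ∘ sym)
  ... | no z≢x   | no z′≢x  = ≡⇔≡ h (∈L z∈ z≢x) (∈L z′∈ z′≢x)

extend-pattern : ∀ {D₁ D₂ : Set} → DecidableEquality D₁ → ∀ {L} {v₁ : ℕ → D₁} {v₂ : ℕ → D₂} →
  AtLeast D₂ (suc (length L)) → SamePattern (_∈ L) v₁ v₂ → ∀ x d₁ →
  Σ D₂ λ d₂ → SamePattern (_∈ x ∷ L) (update v₁ x d₁) (update v₂ x d₂)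
extend-pattern _≟₁_ {L} {v₁} {v₂} big h x d₁ = witness (any? (λ y → ¬? (y ≟ x) ×-dec (v₁ y ≟₁ d₁)) L)
  where
  witness : Dec (Data.List.Relation.Unary.Any.Any (λ y → y ≢ x × v₁ y ≡ d₁) L) →
            Σ _ λ d₂ → SamePattern (_∈ x ∷ L) (update v₁ x d₁) (update v₂ x d₂)
  witness (yes ∃y) =
    let y , y∈L , _ , v₁y≡d₁ = find ∃y
    in v₂ y , update-pattern x (λ z∈L _ → mk⇔ (λ d₁≡v₁z → to (≡⇔≡ h y∈L z∈L) (trans v₁y≡d₁ d₁≡v₁z))
                                                (λ v₂y≡v₂z → trans (sym v₁y≡d₁) (from (≡⇔≡ h y∈L z∈L) v₂y≡v₂z))) h
  witness (no ∄y) =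
    let d₂ , d₂∉ = big (map v₂ L) (s≤s (≤-reflexive (length-map v₂ L)))
    in d₂ , update-pattern x (λ z∈L z≢x → mk⇔ (λ d₁≡v₁z → contradiction (lose z∈L (z≢x , sym d₁≡v₁z)) ∄y)
                                              (λ d₂≡v₂z → contradiction (subst (_∈ map v₂ L) (sym d₂≡v₂z) (∈-map⁺ v₂ z∈L)) d₂∉)) h

ef-transfer : ∀ {D₁ D₂ : Set} → DecidableEquality D₁ → DecidableEquality D₂ →
  ∀ φ L {v₁ : ℕ → D₁} {v₂ : ℕ → D₂} → (∀ {x} → x ∈ fv φ → x ∈ L) →
  AtLeast D₁ (length L + depth φ) → AtLeast D₂ (length L + depth φ) →
  SamePattern (_∈ L) v₁ v₂ → sat D₁ v₁ φ → sat D₂ v₂ φ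
ef-transfer _ _ top _ _ _ _ _ _ = tt
ef-transfer _ _ (eq x y) L fv⊆L _ _ h s = to (≡⇔≡ h (fv⊆L (here refl)) (fv⊆L (there (here refl)))) s
ef-transfer _≟₁_ _≟₂_ (neg φ) L fv⊆L big₁ big₂ h ¬s = ¬s ∘ ef-transfer _≟₂_ _≟₁_ φ L fv⊆L big₂ big₁ (pattern-sym h)
ef-transfer _≟₁_ _≟₂_ (and φ ψ) L fv⊆L big₁ big₂ h (s , t) =
  ef-transfer _≟₁_ _≟₂_ φ L (fv⊆L ∘ ∈-++⁺ˡ) (AtLeast-mono ≤φ big₁) (AtLeast-mono ≤φ big₂) h s ,
  ef-transfer _≟₁_ _≟₂_ ψ L (fv⊆L ∘ ∈-++⁺ʳ (fv φ)) (AtLeast-mono ≤ψ big₁) (AtLeast-mono ≤ψ big₂) h t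
  where
  ≤φ = +-monoʳ-≤ (length L) (m≤m⊔n (depth φ) (depth ψ))
  ≤ψ = +-monoʳ-≤ (length L) (m≤n⊔m (depth φ) (depth ψ))
ef-transfer {D₁} {D₂} _≟₁_ _≟₂_ (ex x φ) L fv⊆L big₁ big₂ h (d₁ , s) =
  let d₂ , h′ = extend-pattern _≟₁_ (AtLeast-mono 1+L≤ big₂) h x d₁
  in d₂ , ef-transfer _≟₁_ _≟₂_ φ (x ∷ L) fv⊆x∷L (subst (AtLeast D₁) (+-suc _ _) big₁)
                                                  (subst (AtLeast D₂) (+-suc _ _) big₂) h′ s
  where
  1+L≤ : suc (length L) ≤ length L + suc (depth φ)
  1+L≤ = subst (suc (length L) ≤_) (sym (+-suc (length L) (depth φ))) (s≤s (m≤m+n _ _))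
  fv⊆x∷L : ∀ {y} → y ∈ fv φ → y ∈ x ∷ L
  fv⊆x∷L {y} y∈ with y ≟ x
  ... | yes y≡x = here y≡x
  ... | no  y≢x = there (fv⊆L (∈-filter⁺ (λ z → ¬? (z ≟ x)) y∈ y≢x))

BoundedSizes : (Fm → Set) → Set₁
BoundedSizes Γ = Σ ℕ λ N → ∀ n → ModelOfSize Γ n → n < N

Unbounded : (Fm → Set) → Set₁
Unbounded Γ = ∀ N → Σ ℕ λ n → N ≤ n × ModelOfSize Γ n

CofiniteSizes : (Fm → Set) → Set₁
CofiniteSizes Γ = Σ ℕ λ N → ∀ n → N ≤ n → ModelOfSize Γ n

ℕ-model : ∀ Γ → (∀ ψ → Γ ψ → Sentence ψ) → Unbounded Γ → ∀ v → TInterp Γ (record { D = ℕ ; val = v })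
ℕ-model Γ sentences unbounded v ψ ψ∈Γ =
  let n , depth≤n , A , ⊨Γ , iso = unbounded (depth ψ)
  in ef-transfer (↔-decidableEquality iso) _≟_ ψ [] (subst (_ ∈_) (sentences ψ ψ∈Γ))
       (AtLeast-mono depth≤n (AtLeast-↔Fin iso)) (AtLeast-ℕ _) (same-pattern λ ()) (⊨Γ ψ ψ∈Γ)

ℕ-infinite : InfiniteType ℕ
ℕ-infinite (n , iso) =
  let i , j , i<j , same = pigeonhole (n<1+n n) (Inverse.to iso ∘ toℕ)
  in Data.Fin.Properties.<⇒≢ i<j (toℕ-injective (↔-to-injective iso same))


sat-conj : ∀ {D : Set} {v : ℕ → D} l → sat D v (conj l) ⇔ (∀ {φ} → φ ∈ l → sat D v φ)
sat-conj l = mk⇔ (all l) (conj-sat l)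
  where
  all : ∀ l → sat _ _ (conj l) → ∀ {φ} → φ ∈ l → sat _ _ φ
  all (φ ∷ l) (s , _)  (here refl) = s
  all (φ ∷ l) (_ , ss) (there φ∈) = all l ss φ∈
  conj-sat : ∀ l → (∀ {φ} → φ ∈ l → sat _ _ φ) → sat _ _ (conj l)
  conj-sat []      _ = tt
  conj-sat (φ ∷ l) h = h (here refl) , conj-sat l (h ∘ there)

fv-conj : ∀ l {x} → x ∈ fv (conj l) → Σ Fm λ φ → φ ∈ l × x ∈ fv φ
fv-conj (φ ∷ l) x∈ with ∈-++⁻ (fv φ) x∈
... | inj₁ x∈φ = φ , here refl , x∈φ
... | inj₂ x∈l = let ψ , ψ∈ , x∈ψ = fv-conj l x∈l in ψ , there ψ∈ , x∈ψ

literal : (ℕ → ℕ) → ℕ → ℕ → Fm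
literal e x y = if e x ≡ᵇ e y then eq x y else neg (eq x y)

arr≡conj : ∀ V e → arr V e ≡ conj (cartesianProductWith (literal e) V V)
arr≡conj V e = cong conj (concatMap≡ V)
  where
  concatMap≡ : ∀ U → concatMap (λ x → map (literal e x) V) U ≡ cartesianProductWith (literal e) U V
  concatMap≡ []      = refl
  concatMap≡ (x ∷ U) = cong (map (literal e x) V ++_) (concatMap≡ U)

sat-literal : ∀ {D : Set} (v : ℕ → D) e x y → sat D v (literal e x y) ⇔ ((v x ≡ v y) ⇔ (e x ≡ e y))
sat-literal v e x y with e x ≡ᵇ e y in h
... | true  = mk⇔ (λ s → mk⇔ (λ _ → ex≡ey) (λ _ → s)) (λ v≡⇔e≡ → from v≡⇔e≡ ex≡ey)
  where ex≡ey = ≡ᵇ⇒≡ (e x) (e y) (subst T (sym h) tt)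
... | false = mk⇔ (λ ¬s → mk⇔ (λ s → contradiction s ¬s) (λ e≡ → contradiction e≡ ex≢ey))
                  (λ v≡⇔e≡ → ex≢ey ∘ to v≡⇔e≡)
  where ex≢ey = λ ex≡ey → subst T h (≡⇒≡ᵇ (e x) (e y) ex≡ey)

sat-arr : ∀ {D : Set} (v : ℕ → D) V e → sat D v (arr V e) ⇔ SamePattern (_∈ V) v e
sat-arr v V e rewrite arr≡conj V e = mk⇔
  (λ s → same-pattern λ x∈ y∈ →
     to (sat-literal v e _ _) (to (sat-conj literals) s (∈-cartesianProductWith⁺ (literal e) x∈ y∈)))
  (λ h → from (sat-conj literals) λ φ∈ →
     let x , y , x∈ , y∈ , φ≡ = ∈-cartesianProductWith⁻ (literal e) V V φ∈
     in subst (sat _ v) (sym φ≡) (from (sat-literal v e x y) (≡⇔≡ h x∈ y∈)))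
  where literals = cartesianProductWith (literal e) V V

fv-arr : ∀ V e {x} → x ∈ fv (arr V e) → x ∈ V
fv-arr V e {x} x∈ rewrite arr≡conj V e with fv-conj (cartesianProductWith (literal e) V V) x∈
... | φ , φ∈ , x∈φ with ∈-cartesianProductWith⁻ (literal e) V V φ∈
... | a , b , a∈ , b∈ , refl = endpoint (e a ≡ᵇ e b) x∈φ
  where
  endpoint : ∀ c → x ∈ fv (if c then eq a b else neg (eq a b)) → x ∈ V
  endpoint true  (here refl)         = a∈
  endpoint true  (there (here refl)) = b∈
  endpoint false (here refl)         = a∈
  endpoint false (there (here refl)) = b∈

-- Strongly finitely witnessable theories with unboundedly large models have all large sizes

sat-exs : ∀ {D : Set} (v : ℕ → D) xs ψ → sat D v (exs xs ψ) → Σ (ℕ → D) λ v′ → sat D v′ ψ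
sat-exs v []       ψ s       = v , s
sat-exs v (x ∷ xs) ψ (d , s) = sat-exs (update v x d) xs ψ s

crossing : ∀ {P : ℕ → Set} → (∀ n → Dec (P n)) → ¬ P 0 → ∀ {n} → P n → Σ ℕ λ c → ¬ P c × P (suc c)
crossing P? ¬P0 {zero}  p = contradiction p ¬P0
crossing P? ¬P0 {suc n} p with P? n
... | yes pn = crossing P? ¬P0 pn
... | no ¬pn = n , ¬pn , p

-- If some value i were missed, punching it out would satisfy φ in a smaller domain.
minimal⇒onto : ∀ φ → QF φ → ∀ {c} (g : ℕ → Fin (suc c)) → sat (Fin (suc c)) g φ → ¬ SatIn c φ →
               ∀ i → Σ ℕ λ x → x ≤ enc φ × g x ≡ i
minimal⇒onto φ qf {c} g s ¬sat i with anyUpTo? (λ x → g x Fin.≟ i) (suc (enc φ))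
... | yes (x , x<1+B , gx≡i) = x , ≤-pred x<1+B , gx≡i
... | no ∄x = contradiction (g′ , to (sat-pattern φ qf (fv≤enc φ) g~g′) s) ¬sat
  where
  B = enc φ
  missed : ∀ {x} → x ≤ B → i ≢ g x
  missed x≤B i≡gx = ∄x (_ , s≤s x≤B , sym i≡gx)
  g′ : ℕ → Fin c
  g′ x = Fin.punchOut (missed (m⊓n≤n x B))
  g~g′ : SamePattern (_≤ B) g g′
  g~g′ = pattern-trans (pattern-≗ {w = g ∘ (_⊓ B)} (λ x≤B → cong g (sym (m≤n⇒m⊓n≡m x≤B))))
                       (same-pattern λ _ _ →
                          mk⇔ (punchOut-cong i) (punchOut-injective (missed (m⊓n≤n _ B)) (missed (m⊓n≤n _ B))))

padded : ∀ {c} → (ℕ → Fin c) → ℕ → ℕ → ℕ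
padded {c} g B x with x ≤? B
... | yes _ = toℕ (g x)
... | no  _ = c + (x ∸ suc B)

padded-≤ : ∀ {c} (g : ℕ → Fin c) B {x} → x ≤ B → padded g B x ≡ toℕ (g x)
padded-≤ g B {x} x≤B with x ≤? B
... | yes _    = refl
... | no  x≰B  = contradiction x≤B x≰B

padded-> : ∀ {c} (g : ℕ → Fin c) B {x} → B < x → padded g B x ≡ c + (x ∸ suc B)
padded-> g B {x} B<x with x ≤? B
... | yes x≤B = contradiction x≤B (<⇒≱ B<x)
... | no  _   = refl

padded-< : ∀ {c} (g : ℕ → Fin c) B k {x} → x < suc B + k → padded g B x < c + k
padded-< {c} g B k {x} x< with x ≤? B
... | yes _   = <-≤-trans (toℕ<n (g x)) (m≤m+n c k)
... | no  x≰B = +-monoʳ-< c (+-cancelˡ-< (suc B) _ _ (subst (_< suc B + k) (sym (m+[n∸m]≡n (≰⇒> x≰B))) x<))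

padded-onto : ∀ {c} (g : ℕ → Fin c) B k → (∀ i → Σ ℕ λ x → x ≤ B × g x ≡ i) →
              ∀ {i} → i < c + k → Σ ℕ λ x → x < suc B + k × padded g B x ≡ i
padded-onto {c} g B k onto {i} i< with i <? c
... | yes i<c = let x , x≤B , gx≡ = onto (fromℕ< i<c)
                in x , ≤-trans (s≤s x≤B) (m≤m+n (suc B) k) ,
                   trans (padded-≤ g B x≤B) (trans (cong toℕ gx≡) (toℕ-fromℕ< i<c))
... | no  i≮c = suc B + (i ∸ c) ,
                +-monoʳ-< (suc B) (+-cancelˡ-< c _ _ (subst (_< c + k) (sym (m+[n∸m]≡n (≮⇒≥ i≮c))) i<)) ,
                trans (padded-> g B (≤-trans (n<1+n B) (m≤m+n (suc B) _)))
                      (trans (cong (c +_) (m+n∸m≡n (suc B) (i ∸ c))) (m+[n∸m]≡n (≮⇒≥ i≮c)))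

cover-iso : ∀ {D : Set} (a : ℕ → D) (v : ℕ → ℕ) {M N} →
  (∀ d → Σ ℕ λ x → x < M × a x ≡ d) → SamePattern (_< M) a v →
  (∀ {x} → x < M → v x < N) → (∀ {i} → i < N → Σ ℕ λ x → x < M × v x ≡ i) → D ↔ Fin N
cover-iso a v cover h v< onto = mk↔ₛ′ encode decode encode∘decode decode∘encode
  where
  encode = λ d → fromℕ< (v< (proj₁ (proj₂ (cover d))))
  decode = λ i → a (proj₁ (onto (toℕ<n i)))
  encode∘decode : ∀ i → encode (decode i) ≡ i
  encode∘decode i =
    let y , y< , vy≡i = onto (toℕ<n i)
        x , x< , ax≡ay = cover (a y)
    in toℕ-injective (trans (toℕ-fromℕ< _) (trans (to (≡⇔≡ h x< y<) ax≡ay) vy≡i))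
  decode∘encode : ∀ d → decode (encode d) ≡ d
  decode∘encode d =
    let x , x< , ax≡d = cover d
        y , y< , vy≡ = onto (toℕ<n (fromℕ< (v< x<)))
    in trans (from (≡⇔≡ h y< x<) (trans vy≡ (toℕ-fromℕ< _))) ax≡d

WitnessesArrangements : (Fm → Set) → Fm → Set₁
WitnessesArrangements Γ w = ∀ V e → TSat Γ (and w (arr V e)) →
  Σ Interp λ A → TInterp Γ A × A ⊨ and w (arr V e) ×
                 (∀ d → Σ ℕ λ x → x ∈ fv (and w (arr V e)) × val A x ≡ d)

-- (II*) applied to the arrangement of `padded g` on the variables < 1 + B + k gives a model covered by
-- these variables, on which it takes exactly the c + k values of `padded g`.
model-of-each-larger-size : ∀ Γ → (∀ ψ → Γ ψ → Sentence ψ) → Unbounded Γ →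
  ∀ w → QF w → WitnessesArrangements Γ w → ∀ {c} (g : ℕ → Fin c) → sat (Fin c) g w →
  (∀ i → Σ ℕ λ x → x ≤ enc w × g x ≡ i) → ∀ k → ModelOfSize Γ (c + k)
model-of-each-larger-size Γ sentences unbounded w qf arrange {c} g ⊨w onto k =
  let A , ⊨Γ , (_ , ⊨arr) , cover = arrange V v ⊨arrangement
  in A , ⊨Γ , cover-iso (val A) v (covered A cover) (A~v A ⊨arr) (padded-< g B k) (padded-onto g B k onto)
  where
  B = enc w
  V = upTo (suc B + k)
  v = padded g B
  ⊨arrangement : TSat Γ (and w (arr V v))
  ⊨arrangement = record { D = ℕ ; val = v } , ℕ-model Γ sentences unbounded v ,
                 from (sat-pattern w qf (fv≤enc w) (toℕ-pattern (sym ∘ padded-≤ g B))) ⊨w ,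
                 from (sat-arr v V v) (same-pattern λ _ _ → ⇔-refl)
  A~v : ∀ A → A ⊨ arr V v → SamePattern (_< suc B + k) (val A) v
  A~v A ⊨arr = same-pattern λ x< y< → ≡⇔≡ (to (sat-arr (val A) V v) ⊨arr) (∈-upTo⁺ x<) (∈-upTo⁺ y<)
  covered : ∀ A → (∀ d → Σ ℕ λ x → x ∈ fv (and w (arr V v)) × val A x ≡ d) →
            ∀ d → Σ ℕ λ x → x < suc B + k × val A x ≡ d
  covered A cover d with cover d
  ... | x , x∈ , ax≡d with ∈-++⁻ (fv w) x∈
  ...   | inj₁ x∈w   = x , ≤-trans (s≤s (fv≤enc w x∈w)) (m≤m+n (suc B) k) , ax≡d
  ...   | inj₂ x∈arr = x , ∈-upTo⁻ (fv-arr V v x∈arr) , ax≡d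

-- wit top is satisfiable (in the model on ℕ); take the least domain size c + 1 in which it is.
unbounded-witnessable⇒cofinite : ∀ Γ → (∀ ψ → Γ ψ → Sentence ψ) → Unbounded Γ →
                                 StronglyFinitelyWitnessable Γ → CofiniteSizes Γ
unbounded-witnessable⇒cofinite Γ sentences unbounded (wit , _ , props) =
  let qf , equiv , arrange = props top tt
      w = wit top
      ℕ-id = record { D = ℕ ; val = λ x → x }
      _ , ⊨w = sat-exs (λ x → x) (newVars top w) w (proj₁ (equiv ℕ-id (ℕ-model Γ sentences unbounded _)) tt)
      SatIn? = λ n → map-Dec (satInᴺ-correct n w qf) (0 <? satInᴺ n (enc w))
      c , ¬sat , g , ⊨w′ = crossing SatIn? (λ (g , _) → case g 0 of λ ()) (sat⇒SatIn _≟_ w qf ⊨w (n<1+n (enc w)))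
      model = model-of-each-larger-size Γ sentences unbounded w qf arrange g ⊨w′ (minimal⇒onto w qf g ⊨w′ ¬sat)
  in suc c , λ n 1+c≤n → subst (ModelOfSize Γ) (m+[n∸m]≡n 1+c≤n) (model (n ∸ suc c))

-- Gentleness from a computable set of model sizes

-- the largest k < B with 0 < Q k, and 0 if there is none
maxBelow : (ℕ → ℕ) → ℕ → ℕ
maxBelow Q B = iterate B 0 λ k acc → sg (Q k) * k + (1 ∸ sg (Q k)) * acc

maxBelowᴱ : Exp 1 → Exp 2 → Exp 1
maxBelowᴱ B Q = rec B (lit 0) (add (mul (sgᴱ (call Q (var (# 2) ∷ var (# 0) ∷ []))) (var (# 0)))
                                   (mul (notᴱ (sgᴱ (call Q (var (# 2) ∷ var (# 0) ∷ [])))) (var (# 1))))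

maxBelow-none : ∀ Q B → (∀ {i} → i < B → ¬ 0 < Q i) → maxBelow Q B ≡ 0
maxBelow-none Q zero    _    = refl
maxBelow-none Q (suc B) none rewrite ¬0<⇒≡0 (none (n<1+n B)) =
  trans (+-identityʳ _) (maxBelow-none Q B (none ∘ m<n⇒m<1+n))

maxBelow-some : ∀ Q B {i} → i < B → 0 < Q i →
                0 < Q (maxBelow Q B) × (∀ {j} → j < B → 0 < Q j → j ≤ maxBelow Q B)
maxBelow-some Q (suc B) {i} i<1+B Qi>0 with 0 <? Q B
... | yes QB>0 rewrite sg-pos QB>0 =
  subst (λ m → 0 < Q m) (sym B≡) QB>0 , λ j<1+B _ → subst (_ ≤_) (sym B≡) (≤-pred j<1+B)
  where
  B≡ : 1 * B + 0 * maxBelow Q B ≡ B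
  B≡ = trans (+-identityʳ (B + 0)) (+-identityʳ B)
... | no ¬QB>0 rewrite ¬0<⇒≡0 ¬QB>0 | +-identityʳ (maxBelow Q B) =
  let max , ≤max = maxBelow-some Q B (below i<1+B Qi>0) Qi>0 in max , λ j<1+B Qj>0 → ≤max (below j<1+B Qj>0) Qj>0
  where
  below : ∀ {j} → j < suc B → 0 < Q j → j < B
  below {j} j<1+B Qj>0 with m<1+n⇒m<n∨m≡n j<1+B
  ... | inj₁ j<B  = j<B
  ... | inj₂ refl = contradiction Qj>0 ¬QB>0

isMax-maxBelow : ∀ (X : ℕ → Set₁) Q B → (∀ k → 0 < Q k ⇔ X k) → (∀ k → X k → k < B) →
                 IsMax X (maxBelow Q B)
isMax-maxBelow X Q B Q⇔X X<B with anyUpTo? (λ i → 0 <? Q i) B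
... | yes (i , i<B , Qi>0) = let max , ≤max = maxBelow-some Q B i<B Qi>0 in
  inj₁ (to (Q⇔X _) max , λ k Xk → ≤max (X<B k Xk) (from (Q⇔X k) Xk))
... | no ∄i =
  inj₂ ((λ k Xk → ∄i (k , X<B k Xk , from (Q⇔X k) Xk)) , maxBelow-none Q B λ i<B Qi>0 → ∄i (_ , i<B , Qi>0))

¬finite×cofinite : ∀ (X : ℕ → Set₁) → FiniteSet X → ¬ CoFiniteSet X
¬finite×cofinite X (N , finite) (N′ , cofinite) =
  <-irrefl refl (≤-<-trans (m≤n+m N N′) (finite (N′ + N) (cofinite (N′ + N) (m≤m+n N′ N))))

compile⇓ : ∀ {n} (e : Exp n) xs {y} → ⟦ e ⟧ xs ≡ y → compile e [ xs ]⇓ y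
compile⇓ e xs = ⇓-cast (compile-correct e xs)

Decides : Exp 1 → (ℕ → Set₁) → Set₁
Decides e X = ∀ n → 0 < ⟦ e ⟧ (n ∷ []) ⇔ X n

module Gentleness (Γ : Fm → Set) (sentences : ∀ ψ → Γ ψ → Sentence ψ)
                  (sizeᴱ : Exp 1) (sizeᴱ-correct : Decides sizeᴱ (ModelOfSize Γ)) where

  specᴱ : Exp 2
  specᴱ = mul (call sizeᴱ (var (# 1) ∷ [])) (call satInᴱ (var (# 1) ∷ var (# 0) ∷ []))

  specᴱ-correct : ∀ φ → QF φ → ∀ n → 0 < ⟦ specᴱ ⟧ (enc φ ∷ n ∷ []) ⇔ Spec Γ φ n
  specᴱ-correct φ qf n rewrite satInᴺ-eval n (enc φ) =
    ⇔-trans (0<m*n⇔ _ _) (⇔-trans (sizeᴱ-correct n ×-⇔ satInᴺ-correct n φ qf)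
                                  (⇔-sym (Spec⇔ Γ sentences φ qf n)))

  spectrum-decidable : Σ (PR 2) λ c → ∀ φ → QF φ → ∀ n →
    (Spec Γ φ n → c [ enc φ ∷ n ∷ [] ]⇓ 1) × (¬ Spec Γ φ n → c [ enc φ ∷ n ∷ [] ]⇓ 0)
  spectrum-decidable = compile (sgᴱ specᴱ) , λ φ qf n →
    (λ spec → compile⇓ (sgᴱ specᴱ) _ (sg-pos (from (specᴱ-correct φ qf n) spec))) ,
    (λ ¬spec → compile⇓ (sgᴱ specᴱ) _ (cong sg (¬0<⇒≡0 (¬spec ∘ to (specᴱ-correct φ qf n)))))

  bounded⇒gentle : BoundedSizes Γ → Gentle Γ
  bounded⇒gentle (N , bounded) =
    spectrum-decidable ,
    (λ φ qf → inj₁ (finite φ qf)) ,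
    (compile (lit 1) , λ φ qf → (λ _ → compile-correct (lit 1) _) , ⊥-elim ∘ ¬finite×cofinite _ (finite φ qf)) ,
    (compile maxᴱ , λ φ qf →
       (λ _ → _ , isMax-maxBelow (Spec Γ φ) _ N (specᴱ-correct φ qf) (proj₂ (finite φ qf)) , compile-correct maxᴱ _) ,
       ⊥-elim ∘ ¬finite×cofinite _ (finite φ qf))
    where
    finite : ∀ φ → QF φ → FiniteSet (Spec Γ φ)
    finite φ qf = N , λ n spec → bounded n (proj₁ (to (Spec⇔ Γ sentences φ qf n) spec))
    maxᴱ = maxBelowᴱ (lit N) specᴱ

  -- φ is satisfiable in some domain iff it is in one of size 1 + enc φ, and then in all larger ones.
  module _ (N : ℕ) (cofinite : ∀ n → N ≤ n → ModelOfSize Γ n) where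

    satisfiableᴱ : Exp 1
    satisfiableᴱ = call satInᴱ (add (lit 1) (var (# 0)) ∷ var (# 0) ∷ [])

    satisfiable⇔ : ∀ φ → QF φ → 0 < ⟦ satisfiableᴱ ⟧ (enc φ ∷ []) ⇔ SatIn (suc (enc φ)) φ
    satisfiable⇔ φ qf rewrite satInᴺ-eval (suc (enc φ)) (enc φ) = satInᴺ-correct (suc (enc φ)) φ qf

    all-large : ∀ φ → QF φ → SatIn (suc (enc φ)) φ → ∀ n → N + suc (enc φ) ≤ n → Spec Γ φ n
    all-large φ qf (w , s) n ≤n = from (Spec⇔ Γ sentences φ qf n)
      (cofinite n (m+n≤o⇒m≤o N ≤n) , sat⇒SatIn Fin._≟_ φ qf s (m+n≤o⇒n≤o N ≤n))

    none : ∀ φ → QF φ → ¬ SatIn (suc (enc φ)) φ → ∀ n → ¬ Spec Γ φ n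
    none φ qf ¬sat n spec =
      let w , s = proj₂ (to (Spec⇔ Γ sentences φ qf n) spec) in ¬sat (sat⇒SatIn Fin._≟_ φ qf s ≤-refl)

    finite⊎cofinite : ∀ φ → QF φ → FiniteSet (Spec Γ φ) ⊎ CoFiniteSet (Spec Γ φ)
    finite⊎cofinite φ qf with 0 <? ⟦ satisfiableᴱ ⟧ (enc φ ∷ [])
    ... | yes p = inj₂ (N + suc (enc φ) , all-large φ qf (to (satisfiable⇔ φ qf) p))
    ... | no ¬p = inj₁ (0 , λ n spec → contradiction spec (none φ qf (¬p ∘ from (satisfiable⇔ φ qf)) n))

    finite⇒¬SatIn : ∀ φ → QF φ → FiniteSet (Spec Γ φ) → ¬ SatIn (suc (enc φ)) φ
    finite⇒¬SatIn φ qf fin sat = ¬finite×cofinite _ fin (N + suc (enc φ) , all-large φ qf sat)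

    cofinite⇒SatIn : ∀ φ → QF φ → CoFiniteSet (Spec Γ φ) → SatIn (suc (enc φ)) φ
    cofinite⇒SatIn φ qf (N′ , cof) with 0 <? ⟦ satisfiableᴱ ⟧ (enc φ ∷ [])
    ... | yes p = to (satisfiable⇔ φ qf) p
    ... | no ¬p = contradiction (cof N′ ≤-refl) (none φ qf (¬p ∘ from (satisfiable⇔ φ qf)) N′)

    finite⇒satisfiableᴱ≡0 : ∀ φ → QF φ → FiniteSet (Spec Γ φ) → ⟦ satisfiableᴱ ⟧ (enc φ ∷ []) ≡ 0
    finite⇒satisfiableᴱ≡0 φ qf fin = ¬0<⇒≡0 (finite⇒¬SatIn φ qf fin ∘ to (satisfiable⇔ φ qf))

    cofinite⇒satisfiableᴱ≡1 : ∀ φ → QF φ → CoFiniteSet (Spec Γ φ) → ⟦ satisfiableᴱ ⟧ (enc φ ∷ []) ≡ 1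
    cofinite⇒satisfiableᴱ≡1 φ qf cof =
      ≤-antisym (subst (_≤ 1) (sym (satInᴺ-eval (suc (enc φ)) (enc φ))) (satInᴺ≤1 _ _))
                (from (satisfiable⇔ φ qf) (cofinite⇒SatIn φ qf cof))

    cofinite⇒gentle : Gentle Γ
    cofinite⇒gentle =
      spectrum-decidable ,
      finite⊎cofinite ,
      (compile (notᴱ satisfiableᴱ) , λ φ qf →
         (λ fin → compile⇓ (notᴱ satisfiableᴱ) _ (cong (1 ∸_) (finite⇒satisfiableᴱ≡0 φ qf fin))) ,
         (λ cof → compile⇓ (notᴱ satisfiableᴱ) _ (cong (1 ∸_) (cofinite⇒satisfiableᴱ≡1 φ qf cof)))) ,
      (compile maxᴱ , λ φ qf →
         (λ fin → 0 , inj₂ (none φ qf (finite⇒¬SatIn φ qf fin) , refl) ,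
                  compile⇓ maxᴱ _ (cong (_* gap φ) (finite⇒satisfiableᴱ≡0 φ qf fin))) ,
         (λ cof → gap φ , isMax-maxBelow (λ k → ¬ Spec Γ φ k) _ (N + suc (enc φ))
                            (λ k → ⇔-trans (0<1∸n⇔¬0<n _) (→-cong-⇔ (specᴱ-correct φ qf k) ⇔-refl))
                            (λ k ¬spec → ≰⇒> λ ≤k → ¬spec (all-large φ qf (cofinite⇒SatIn φ qf cof) k ≤k)) ,
                  compile⇓ maxᴱ _ (trans (cong (_* gap φ) (cofinite⇒satisfiableᴱ≡1 φ qf cof)) (+-identityʳ _))))
      where
      maxᴱ = mul satisfiableᴱ (maxBelowᴱ (add (lit N) (add (lit 1) (var (# 0)))) (notᴱ specᴱ))
      gap : Fm → ℕ
      gap φ = maxBelow (λ k → 1 ∸ ⟦ specᴱ ⟧ (enc φ ∷ k ∷ [])) (N + suc (enc φ))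

-- Classical part: excluded middle enters only here

module _ (em : ExcludedMiddle (lsuc lzero)) where

  decidableEquality : ∀ {X : Set} → DecidableEquality X
  decidableEquality a b with em {Lift (lsuc lzero) (a ≡ b)}
  ... | yes a≡b = yes (lower a≡b)
  ... | no  a≢b = no (a≢b ∘ lift)

  indicator : (ℕ → Set₁) → ℕ → ℕ
  indicator X n with em {X n}
  ... | yes _ = 1
  ... | no  _ = 0

  indicator<2 : ∀ X n → indicator X n < 2
  indicator<2 X n with em {X n}
  ... | yes _ = s<s z<s
  ... | no  _ = z<s

  0<indicator⇔ : ∀ X n → 0 < indicator X n ⇔ X n
  0<indicator⇔ X n with em {X n}
  ... | yes x = mk⇔ (λ _ → x) (λ _ → z<s)
  ... | no ¬x = mk⇔ (λ ()) (λ x → contradiction x ¬x)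

  -- The indicator of X on [0, N) is finite data: the bits of a single number.
  initial-segment-decidable : ∀ (X : ℕ → Set₁) N → Σ (Exp 1) λ e → Decides e λ n → n < N × X n
  initial-segment-decidable X N = bitᴱ (lit (fromDigits 2 (indicator X) N)) (var (# 0)) , decides
    where
    decides : ∀ n → 0 < bitᴺ (fromDigits 2 (indicator X) N) n ⇔ (n < N × X n)
    decides n with n <? N
    ... | yes n<N = ⇔-trans (bit-fromDigits (indicator X) N (indicator<2 X) n<N)
                            (⇔-trans (0<indicator⇔ X n) (mk⇔ (n<N ,_) proj₂))
    ... | no  n≮N = mk⇔ (λ p → contradiction p (bit-fromDigits-beyond (indicator X) N (indicator<2 X) (≮⇒≥ n≮N)))
                        (λ (n<N , _) → contradiction n<N n≮N)

  bounded-sizes-decidable : ∀ Γ → BoundedSizes Γ → Σ (Exp 1) λ e → Decides e (ModelOfSize Γ)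
  bounded-sizes-decidable Γ (N , bounded) =
    let e , e⇔ = initial-segment-decidable (ModelOfSize Γ) N
    in e , λ n → ⇔-trans (e⇔ n) (mk⇔ proj₂ λ m → bounded n m , m)

  cofinite-sizes-decidable : ∀ Γ → CofiniteSizes Γ → Σ (Exp 1) λ e → Decides e (ModelOfSize Γ)
  cofinite-sizes-decidable Γ (N , cofinite) =
    let e , e⇔ = initial-segment-decidable (ModelOfSize Γ) N
    in add e (monus (add (lit 1) (var (# 0))) (lit N)) , λ n →
         ⇔-trans (0<m+n⇔ _ _) (mk⇔
           (λ { (inj₁ p) → proj₂ (to (e⇔ n) p) ; (inj₂ p) → cofinite n (to (0<1+n∸m⇔m≤n N n) p) })
           (λ m → case n <? N of λ { (yes n<N) → inj₁ (from (e⇔ n) (n<N , m))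
                                   ; (no n≮N)  → inj₂ (from (0<1+n∸m⇔m≤n N n) (≮⇒≥ n≮N)) }))

  bounded⊎unbounded : ∀ Γ → BoundedSizes Γ ⊎ Unbounded Γ
  bounded⊎unbounded Γ with em {BoundedSizes Γ}
  ... | yes bounded = inj₁ bounded
  ... | no ¬bounded = inj₂ large
    where
    large : ∀ N → Σ ℕ λ n → N ≤ n × ModelOfSize Γ n
    large N with em {Σ ℕ λ n → N ≤ n × ModelOfSize Γ n}
    ... | yes l = l
    ... | no ¬l = contradiction (N , λ n m → ≰⇒> λ N≤n → ¬l (n , N≤n , m)) ¬bounded

  unbounded⇒stablyInfinite : ∀ Γ → (∀ ψ → Γ ψ → Sentence ψ) → Unbounded Γ → StablyInfinite Γ
  unbounded⇒stablyInfinite Γ sentences unbounded φ qf (A , _ , ⊨φ) =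
    record { D = ℕ ; val = rep } , ℕ-model Γ sentences unbounded rep ,
    to (sat-pattern φ qf (fv≤enc φ) (representative-pattern decidableEquality (val A) (enc φ))) ⊨φ , ℕ-infinite
    where rep = representative decidableEquality (val A) (enc φ)

  ¬stablyInfinite⇒bounded : ∀ Γ → (∀ ψ → Γ ψ → Sentence ψ) → ¬ StablyInfinite Γ → BoundedSizes Γ
  ¬stablyInfinite⇒bounded Γ sentences ¬si with bounded⊎unbounded Γ
  ... | inj₁ bounded   = bounded
  ... | inj₂ unbounded = contradiction (unbounded⇒stablyInfinite Γ sentences unbounded) ¬si

  witnessable⇒bounded⊎cofinite : ∀ Γ → (∀ ψ → Γ ψ → Sentence ψ) → StronglyFinitelyWitnessable Γ →
                                 BoundedSizes Γ ⊎ CofiniteSizes Γ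
  witnessable⇒bounded⊎cofinite Γ sentences sfw with bounded⊎unbounded Γ
  ... | inj₁ bounded   = inj₁ bounded
  ... | inj₂ unbounded = inj₂ (unbounded-witnessable⇒cofinite Γ sentences unbounded sfw)

  bounded⊎cofinite⇒gentle : ∀ Γ → (∀ ψ → Γ ψ → Sentence ψ) → BoundedSizes Γ ⊎ CofiniteSizes Γ → Gentle Γ
  bounded⊎cofinite⇒gentle Γ sentences (inj₁ bounded) =
    let e , e⇔ = bounded-sizes-decidable Γ bounded in Gentleness.bounded⇒gentle Γ sentences e e⇔ bounded
  bounded⊎cofinite⇒gentle Γ sentences (inj₂ cofinite) =
    let e , e⇔ = cofinite-sizes-decidable Γ cofinite
    in Gentleness.cofinite⇒gentle Γ sentences e e⇔ (proj₁ cofinite) (proj₂ cofinite)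

lemma2 : ExcludedMiddle (lsuc lzero) →
         (Γ : Fm → Set) → (∀ ψ → Γ ψ → Sentence ψ) →
         (¬ StablyInfinite Γ ⊎ StronglyFinitelyWitnessable Γ) →
         Gentle Γ
lemma2 em Γ sentences hypothesis = bounded⊎cofinite⇒gentle em Γ sentences (sizes hypothesis)
  where
  sizes : ¬ StablyInfinite Γ ⊎ StronglyFinitelyWitnessable Γ → BoundedSizes Γ ⊎ CofiniteSizes Γ
  sizes (inj₁ ¬stablyInfinite) = inj₁ (¬stablyInfinite⇒bounded em Γ sentences ¬stablyInfinite)
  sizes (inj₂ witnessable)     = witnessable⇒bounded⊎cofinite em Γ sentences witnessable
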